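{- Let $n \geq 5$. Every standard Young tableau $T \in \mathcal{Y}_n$ is reconstructible from its set of $1$-minors: if $T' \in \mathcal{Y}_n$ has the same set of $1$-minors as $T$, then $T' = T$.
   Context: A partition $\lambda$ of $n$ is a non-increasing finite sequence $(\lambda_1,\ldots,\lambda_m)$ of positive integers summing to $n$; its Young diagram is a left-aligned array of cells with $\lambda_h$ cells in row $h$ (rows counted from the top). A standard Young tableau of shape $\lambda$ is a filling of the Young diagram of $\lambda$ with $1,\ldots,n$, each exactly once, increasing left to right along rows and top to bottom down columns; $\mathcal{Y}_n$ denotes the set of standard Young tableaux with $n$ entries. For $T \in \mathcal{Y}_n$ and $m \in \{1,\ldots,n\}$, the tableau $T - m \in \mathcal{Y}_{n-1}$ is obtained as follows: remove the cell containing $m$, leaving a space; repeatedly, let $R$ be the cell immediately right of the space and $B$ the cell immediately below it (if they exist); if $R$ exists and ($B$ does not exist or the entry of $R$ is smaller than that of $B$), slide $R$ into the space; otherwise, if $B$ exists, slide $B$ into the space; if neither exists, stop (jeu de taquin). Finally renumber every entry $p > m$ as $p-1$. The set of $1$-minors of $T$ is $\{T - m : 1 \leq m \leq n\}$. -}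

module Defs where

open import Data.Nat using (ℕ; zero; suc; _<_; _<ᵇ_; _∸_; _≤_)
open import Data.Nat.Properties using (_≟_)
open import Data.Bool using (Bool; true; false; if_then_else_)
open import Data.Maybe using (Maybe; just; nothing)
open import Data.List using (List; []; _∷_; map; concat; upTo; length; filter; sum)
open import Data.List.Relation.Unary.All using (All)
open import Data.List.Relation.Unary.Linked using (Linked)
open import Data.List.Relation.Binary.Permutation.Propositional using (_↭_)
open import Data.Product using (_×_; ∃-syntax)
open import Relation.Nullary using (¬_; yes; no)
open import Relation.Binary.PropositionalEquality using (_≡_)

-- A tableau is represented as the list of its rows (top to bottom),
-- each row listed left to right.
Tableau : Set
Tableau = List (List ℕ)

data Above : List ℕ → List ℕ → Set where
  above-[] : ∀ {xs} → Above xs []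
  above-∷  : ∀ {x y xs ys} → x < y → Above xs ys → Above (x ∷ xs) (y ∷ ys)

NonEmpty : List ℕ → Set
NonEmpty xs = ¬ (xs ≡ [])

oneTo : ℕ → List ℕ
oneTo n = map suc (upTo n)

-- T is a standard Young tableau with n entries:
--  * all rows nonempty and each row no longer than the one above (shape is
--    the Young diagram of a partition of n; guaranteed by Above),
--  * the entries are exactly 1..n, each once,
--  * rows strictly increase left to right,
--  * columns strictly increase top to bottom.
record IsSYT (n : ℕ) (T : Tableau) : Set where
  field
    rowsNonEmpty : All NonEmpty T
    entries      : concat T ↭ oneTo n
    rowsIncr     : All (Linked _<_) T
    colsIncr     : Linked Above T

SYT : ℕ → Set
SYT n = Data.Product.Σ Tableau (IsSYT n)

-- entry in row r, column c (0-based), if the cell exists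
getRow : List ℕ → ℕ → Maybe ℕ
getRow []       _       = nothing
getRow (x ∷ xs) zero    = just x
getRow (x ∷ xs) (suc c) = getRow xs c

get : Tableau → ℕ → ℕ → Maybe ℕ
get []         _       c = nothing
get (row ∷ T)  zero    c = getRow row c
get (row ∷ T)  (suc r) c = get T r c

setRow : List ℕ → ℕ → ℕ → List ℕ
setRow []       _       v = []
setRow (x ∷ xs) zero    v = v ∷ xs
setRow (x ∷ xs) (suc c) v = x ∷ setRow xs c v

set : Tableau → ℕ → ℕ → ℕ → Tableau
set []        _       c v = []
set (row ∷ T) zero    c v = setRow row c v ∷ T
set (row ∷ T) (suc r) c v = row ∷ set T r c v

delRow : List ℕ → ℕ → List ℕ
delRow []       _       = []
delRow (x ∷ xs) zero    = xs
delRow (x ∷ xs) (suc c) = x ∷ delRow xs c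

isNil : List ℕ → Bool
isNil [] = true
isNil (_ ∷ _) = false

delCell : Tableau → ℕ → ℕ → Tableau
delCell []        _       c = []
delCell (row ∷ T) zero    c with delRow row c
... | []       = T
... | (x ∷ xs) = (x ∷ xs) ∷ T
delCell (row ∷ T) (suc r) c = row ∷ delCell T r c

-- The space is at (r, c) (its stored value is irrelevant). Each slide moves the space to a new cell, so fuel equal to
-- the number of cells suffices.
slide : ℕ → Tableau → ℕ → ℕ → Tableau
slide zero     T r c = delCell T r c
slide (suc f)  T r c with get T r (suc c) | get T (suc r) c
... | just x  | nothing = slide f (set T r c x) r (suc c)
... | nothing | just y  = slide f (set T r c y) (suc r) c
... | nothing | nothing = delCell T r c
... | just x  | just y  = if x <ᵇ y then slide f (set T r c x) r (suc c)
                                     else slide f (set T r c y) (suc r) c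

findRow : List ℕ → ℕ → Maybe ℕ
findRow []       m = nothing
findRow (x ∷ xs) m with x ≟ m
... | yes _ = just zero
... | no  _ with findRow xs m
...   | just c  = just (suc c)
...   | nothing = nothing

find : Tableau → ℕ → Maybe (ℕ × ℕ)
find []        m = nothing
find (row ∷ T) m with findRow row m
... | just c  = just (zero Data.Product., c)
... | nothing with find T m
...   | just (r Data.Product., c) = just (suc r Data.Product., c)
...   | nothing = nothing

size : Tableau → ℕ
size T = length (concat T)

renumber : ℕ → Tableau → Tableau
renumber m = map (map (λ p → if m <ᵇ p then p ∸ 1 else p))

_minus_ : Tableau → ℕ → Tableau
T minus m with find T m
... | nothing = T
... | just (r Data.Product., c) = renumber m (slide (size T) T r c)

IsOneMinor : ℕ → Tableau → Tableau → Set
IsOneMinor n T S = ∃[ m ] (1 ≤ m × m ≤ n × T minus m ≡ S)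

{-# OPTIONS --safe #-}
-- Write T⁻ for T with its largest entry n removed.  Removing the largest entry
-- commutes with taking 1-minors: for m < n the slide computing T − m moves n at
-- most once, as its very last step, so erasing n − 1 from T − m gives T⁻ − m,
-- while T − n = T⁻.  Hence if T and T′ have the same 1-minors then so do T⁻ and
-- T′⁻, and by induction T⁻ = T′⁻ unless they form one of three exceptional pairs
-- of size at most 4, whose extensions are checked by evaluation.  If T⁻ = T′⁻
-- but n lies in different rows a ≠ a′, one of the two, say T, has a corner
-- outside row a.  Deleting that corner gives a 1-minor of T whose row a is one
-- cell longer than in T⁻, while jeu de taquin never lengthens a row, so no
-- 1-minor of T′ has such a row.
module Submission where

open import Defs
open import Data.Bool using (true; false; if_then_else_)
open import Data.Empty using (⊥; ⊥-elim)
open import Data.List using (List; []; _∷_; [_]; _++_; map; concat; length; filter; upTo)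
open import Data.List.Properties using (length-++; length-map; map-++; ++-assoc; ++-identityʳ; concat-++; upTo-∷ʳ; map-id-local; filter-all; filter-reject; filter-++; ≡-dec)
open import Data.List.Membership.Propositional using (_∈_)
open import Data.List.Membership.Propositional.Properties using (∈-map⁺; ∈-map⁻; ∈-upTo⁺; ∈-upTo⁻; ∈-concat⁻′; ∈-∃++; ∈-++⁺ʳ)
open import Data.List.Relation.Unary.All using (All; []; _∷_)
import Data.List.Relation.Unary.All as All
import Data.List.Relation.Unary.All.Properties as All
open import Data.List.Relation.Unary.Any using (here; there)
open import Data.List.Relation.Unary.Linked as Linked using (Linked; []; [-]; _∷_)
open import Data.List.Relation.Binary.Permutation.Propositional using (_↭_; ↭-sym)
open import Data.List.Relation.Binary.Permutation.Propositional.Properties using (All-resp-↭; ∈-resp-↭; ↭-empty-inv; drop-mid)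
open import Data.Maybe using (just; nothing)
open import Data.Maybe.Properties using (just-injective)
open import Data.Nat
open import Data.Nat.Properties
open import Data.Product as Product using (_×_; _,_; ∃-syntax; proj₁; proj₂)
open import Data.Sum as Sum using (_⊎_; inj₁; inj₂)
open import Data.Unit using (⊤; tt)
open import Function using (_∘_)
open import Relation.Binary.PropositionalEquality hiding ([_])
open import Relation.Nullary using (¬_; yes; no; ¬?; Dec)
open import Relation.Nullary.Decidable using (False; toWitnessFalse; _×-dec_)
open import Data.List.Membership.DecPropositional (≡-dec (≡-dec _≟_)) using (_∈?_)

rowLength : Tableau → ℕ → ℕ
rowLength []        i       = 0
rowLength (row ∷ T) zero    = length row
rowLength (row ∷ T) (suc i) = rowLength T i

Young : Tableau → Set
Young T = ∀ i → rowLength T (suc i) ≤ rowLength T i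

Young-tail : ∀ {row T} → Young (row ∷ T) → Young T
Young-tail y i = y (suc i)

getRow-nothing⇒≤ : ∀ xs j → getRow xs j ≡ nothing → length xs ≤ j
getRow-nothing⇒≤ []       j       e  = z≤n
getRow-nothing⇒≤ (x ∷ xs) zero    ()
getRow-nothing⇒≤ (x ∷ xs) (suc j) e  = s≤s (getRow-nothing⇒≤ xs j e)

≤⇒getRow-nothing : ∀ xs j → length xs ≤ j → getRow xs j ≡ nothing
≤⇒getRow-nothing []       j       _         = refl
≤⇒getRow-nothing (x ∷ xs) (suc j) (s≤s le) = ≤⇒getRow-nothing xs j le

<⇒getRow-just : ∀ xs j → j < length xs → ∃[ v ] getRow xs j ≡ just v
<⇒getRow-just (x ∷ xs) zero    _         = x , refl
<⇒getRow-just (x ∷ xs) (suc j) (s≤s lt) = <⇒getRow-just xs j lt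

getRow-just⇒< : ∀ xs j {v} → getRow xs j ≡ just v → j < length xs
getRow-just⇒< (x ∷ xs) zero    e = s≤s z≤n
getRow-just⇒< (x ∷ xs) (suc j) e = s≤s (getRow-just⇒< xs j e)

get-nothing⇒≤ : ∀ T i j → get T i j ≡ nothing → rowLength T i ≤ j
get-nothing⇒≤ []        i       j e = z≤n
get-nothing⇒≤ (row ∷ T) zero    j e = getRow-nothing⇒≤ row j e
get-nothing⇒≤ (row ∷ T) (suc i) j e = get-nothing⇒≤ T i j e

≤⇒get-nothing : ∀ T i j → rowLength T i ≤ j → get T i j ≡ nothing
≤⇒get-nothing []        i       j le = refl
≤⇒get-nothing (row ∷ T) zero    j le = ≤⇒getRow-nothing row j le
≤⇒get-nothing (row ∷ T) (suc i) j le = ≤⇒get-nothing T i j le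

<⇒get-just : ∀ T i j → j < rowLength T i → ∃[ v ] get T i j ≡ just v
<⇒get-just (row ∷ T) zero    j lt = <⇒getRow-just row j lt
<⇒get-just (row ∷ T) (suc i) j lt = <⇒get-just T i j lt

get-just⇒< : ∀ T i j {v} → get T i j ≡ just v → j < rowLength T i
get-just⇒< (row ∷ T) zero    j e = getRow-just⇒< row j e
get-just⇒< (row ∷ T) (suc i) j e = get-just⇒< T i j e

size-∷ : ∀ row T → size (row ∷ T) ≡ length row + size T
size-∷ row T = length-++ row

get-just⇒<size : ∀ T i j {v} → All NonEmpty T → get T i j ≡ just v → i + j < size T
get-just⇒<size (row ∷ T) zero j _ e = begin-strict
  j                     <⟨ getRow-just⇒< row j e ⟩
  length row            ≤⟨ m≤m+n _ _ ⟩
  length row + size T   ≡⟨ size-∷ row T ⟨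
  size (row ∷ T)        ∎
  where open ≤-Reasoning
get-just⇒<size ([] ∷ T) (suc i) j (ne ∷ _) e = ⊥-elim (ne refl)
get-just⇒<size ((x ∷ xs) ∷ T) (suc i) j (_ ∷ ne) e = begin-strict
  suc i + j                  <⟨ s≤s (get-just⇒<size T i j ne e) ⟩
  suc (size T)               ≤⟨ +-monoˡ-≤ (size T) (s≤s z≤n) ⟩
  length (x ∷ xs) + size T   ≡⟨ size-∷ (x ∷ xs) T ⟨
  size ((x ∷ xs) ∷ T)        ∎
  where open ≤-Reasoning

setRow-length : ∀ xs c v → length (setRow xs c v) ≡ length xs
setRow-length []       c       v = refl
setRow-length (x ∷ xs) zero    v = refl
setRow-length (x ∷ xs) (suc c) v = cong suc (setRow-length xs c v)

rowLength-set : ∀ T r c v i → rowLength (set T r c v) i ≡ rowLength T i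
rowLength-set []        r       c v i       = refl
rowLength-set (row ∷ T) zero    c v zero    = setRow-length row c v
rowLength-set (row ∷ T) zero    c v (suc i) = refl
rowLength-set (row ∷ T) (suc r) c v zero    = refl
rowLength-set (row ∷ T) (suc r) c v (suc i) = rowLength-set T r c v i

length-set : ∀ T r c v → length (set T r c v) ≡ length T
length-set []        r       c v = refl
length-set (row ∷ T) zero    c v = refl
length-set (row ∷ T) (suc r) c v = cong suc (length-set T r c v)

size-set : ∀ T r c v → size (set T r c v) ≡ size T
size-set []        r       c v = refl
size-set (row ∷ T) zero    c v = begin
  size (setRow row c v ∷ T)         ≡⟨ size-∷ (setRow row c v) T ⟩
  length (setRow row c v) + size T  ≡⟨ cong (_+ size T) (setRow-length row c v) ⟩
  length row + size T               ≡⟨ size-∷ row T ⟨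
  size (row ∷ T)                    ∎
  where open ≡-Reasoning
size-set (row ∷ T) (suc r) c v = begin
  size (row ∷ set T r c v)         ≡⟨ size-∷ row (set T r c v) ⟩
  length row + size (set T r c v)  ≡⟨ cong (length row +_) (size-set T r c v) ⟩
  length row + size T              ≡⟨ size-∷ row T ⟨
  size (row ∷ T)                   ∎
  where open ≡-Reasoning

All-NonEmpty-set : ∀ T r c v → All NonEmpty T → All NonEmpty (set T r c v)
All-NonEmpty-set []        r       c v []        = []
All-NonEmpty-set ([] ∷ T)  zero    c v (ne ∷ _)  = ⊥-elim (ne refl)
All-NonEmpty-set ((x ∷ xs) ∷ T) zero zero v (_ ∷ ps) = (λ ()) ∷ ps
All-NonEmpty-set ((x ∷ xs) ∷ T) zero (suc c) v (_ ∷ ps) = (λ ()) ∷ ps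
All-NonEmpty-set (row ∷ T) (suc r) c v (p ∷ ps) = p ∷ All-NonEmpty-set T r c v ps

Young-set : ∀ T r c v → Young T → Young (set T r c v)
Young-set T r c v y i =
  subst₂ _≤_ (sym (rowLength-set T r c v (suc i))) (sym (rowLength-set T r c v i)) (y i)

getRow-set-same : ∀ xs c v → c < length xs → getRow (setRow xs c v) c ≡ just v
getRow-set-same (x ∷ xs) zero    v _         = refl
getRow-set-same (x ∷ xs) (suc c) v (s≤s lt) = getRow-set-same xs c v lt

get-set-same : ∀ T r c v → c < rowLength T r → get (set T r c v) r c ≡ just v
get-set-same (row ∷ T) zero    c v lt = getRow-set-same row c v lt
get-set-same (row ∷ T) (suc r) c v lt = get-set-same T r c v lt

getRow-set-inv : ∀ xs c x j {v} → getRow (setRow xs c x) j ≡ just v → v ≡ x ⊎ getRow xs j ≡ just v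
getRow-set-inv []       c       x j       e    = inj₂ e
getRow-set-inv (y ∷ xs) zero    x zero    refl = inj₁ refl
getRow-set-inv (y ∷ xs) zero    x (suc j) e    = inj₂ e
getRow-set-inv (y ∷ xs) (suc c) x zero    e    = inj₂ e
getRow-set-inv (y ∷ xs) (suc c) x (suc j) e    = getRow-set-inv xs c x j e

get-set-inv : ∀ T r c x i j {v} → get (set T r c x) i j ≡ just v → v ≡ x ⊎ get T i j ≡ just v
get-set-inv []        r       c x i       j e = inj₂ e
get-set-inv (row ∷ T) zero    c x zero    j e = getRow-set-inv row c x j e
get-set-inv (row ∷ T) zero    c x (suc i) j e = inj₂ e
get-set-inv (row ∷ T) (suc r) c x zero    j e = inj₂ e
get-set-inv (row ∷ T) (suc r) c x (suc i) j e = get-set-inv T r c x i j e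

addToRow : ℕ → ℕ → Tableau → Tableau
addToRow _       w []        = [ w ] ∷ []
addToRow zero    w (row ∷ T) = (row ++ [ w ]) ∷ T
addToRow (suc a) w (row ∷ T) = row ∷ addToRow a w T

length-snoc : ∀ xs (w : ℕ) → length (xs ++ [ w ]) ≡ suc (length xs)
length-snoc xs w = trans (length-++ xs) (+-comm (length xs) 1)

getRow-snoc-same : ∀ xs w → getRow (xs ++ [ w ]) (length xs) ≡ just w
getRow-snoc-same []       w = refl
getRow-snoc-same (x ∷ xs) w = getRow-snoc-same xs w

getRow-snoc-other : ∀ xs w j → j ≢ length xs → getRow (xs ++ [ w ]) j ≡ getRow xs j
getRow-snoc-other []       w zero    ne = ⊥-elim (ne refl)
getRow-snoc-other []       w (suc j) ne = refl
getRow-snoc-other (x ∷ xs) w zero    ne = refl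
getRow-snoc-other (x ∷ xs) w (suc j) ne = getRow-snoc-other xs w j (ne ∘ cong suc)

get-addToRow-new : ∀ a w Z → a ≤ length Z → get (addToRow a w Z) a (rowLength Z a) ≡ just w
get-addToRow-new zero    w []        _         = refl
get-addToRow-new zero    w (row ∷ Z) _         = getRow-snoc-same row w
get-addToRow-new (suc a) w (row ∷ Z) (s≤s al) = get-addToRow-new a w Z al

get-addToRow-otherRow : ∀ a w Z i j → a ≤ length Z → i ≢ a → get (addToRow a w Z) i j ≡ get Z i j
get-addToRow-otherRow zero    w []        zero    j _         ne = ⊥-elim (ne refl)
get-addToRow-otherRow zero    w []        (suc i) j _         ne = refl
get-addToRow-otherRow zero    w (row ∷ Z) zero    j _         ne = ⊥-elim (ne refl)
get-addToRow-otherRow zero    w (row ∷ Z) (suc i) j _         ne = refl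
get-addToRow-otherRow (suc a) w (row ∷ Z) zero    j _         ne = refl
get-addToRow-otherRow (suc a) w (row ∷ Z) (suc i) j (s≤s al) ne =
  get-addToRow-otherRow a w Z i j al (ne ∘ cong suc)

get-addToRow-otherColumn : ∀ a w Z i j → a ≤ length Z → j ≢ rowLength Z a →
  get (addToRow a w Z) i j ≡ get Z i j
get-addToRow-otherColumn zero    w []        zero    zero    _         ne = ⊥-elim (ne refl)
get-addToRow-otherColumn zero    w []        zero    (suc j) _         ne = refl
get-addToRow-otherColumn zero    w []        (suc i) j       _         ne = refl
get-addToRow-otherColumn zero    w (row ∷ Z) zero    j       _         ne = getRow-snoc-other row w j ne
get-addToRow-otherColumn zero    w (row ∷ Z) (suc i) j       _         ne = refl
get-addToRow-otherColumn (suc a) w (row ∷ Z) zero    j       _         ne = refl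
get-addToRow-otherColumn (suc a) w (row ∷ Z) (suc i) j (s≤s al) ne =
  get-addToRow-otherColumn a w Z i j al ne

get-addToRow : ∀ a w Z i j → a ≤ length Z →
  get (addToRow a w Z) i j ≡ get Z i j ⊎ (i ≡ a × j ≡ rowLength Z a)
get-addToRow a w Z i j al with i ≟ a | j ≟ rowLength Z a
... | no i≢a  | _        = inj₁ (get-addToRow-otherRow a w Z i j al i≢a)
... | yes _   | no j≢len = inj₁ (get-addToRow-otherColumn a w Z i j al j≢len)
... | yes i≡a | yes j≡len = inj₂ (i≡a , j≡len)

get-addToRow-just : ∀ a w Z i j {v} → a ≤ length Z → get (addToRow a w Z) i j ≡ just v →
  get Z i j ≡ just v ⊎ (i ≡ a × j ≡ rowLength Z a × v ≡ w)
get-addToRow-just a w Z i j al e with get-addToRow a w Z i j al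
... | inj₁ same = inj₁ (trans (sym same) e)
... | inj₂ (refl , refl) = inj₂ (refl , refl , just-injective (trans (sym e) (get-addToRow-new a w Z al)))

get-addToRow-old : ∀ a w Z i j {v} → a ≤ length Z → get Z i j ≡ just v → get (addToRow a w Z) i j ≡ just v
get-addToRow-old a w Z i j al e with get-addToRow a w Z i j al
... | inj₁ same = trans same e
... | inj₂ (refl , refl) = ⊥-elim (<-irrefl refl (get-just⇒< Z i j e))

rowLength-addToRow-same : ∀ a w Z → a ≤ length Z → rowLength (addToRow a w Z) a ≡ suc (rowLength Z a)
rowLength-addToRow-same zero    w []        _         = refl
rowLength-addToRow-same zero    w (row ∷ Z) _         = length-snoc row w
rowLength-addToRow-same (suc a) w (row ∷ Z) (s≤s al) = rowLength-addToRow-same a w Z al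

rowLength-addToRow-other : ∀ a w Z i → a ≤ length Z → i ≢ a → rowLength (addToRow a w Z) i ≡ rowLength Z i
rowLength-addToRow-other zero    w []        zero    _         ne = ⊥-elim (ne refl)
rowLength-addToRow-other zero    w []        (suc i) _         ne = refl
rowLength-addToRow-other zero    w (row ∷ Z) zero    _         ne = ⊥-elim (ne refl)
rowLength-addToRow-other zero    w (row ∷ Z) (suc i) _         ne = refl
rowLength-addToRow-other (suc a) w (row ∷ Z) zero    _         ne = refl
rowLength-addToRow-other (suc a) w (row ∷ Z) (suc i) (s≤s al) ne =
  rowLength-addToRow-other a w Z i al (ne ∘ cong suc)

size-addToRow : ∀ a w Z → size (addToRow a w Z) ≡ suc (size Z)
size-addToRow a       w []        = refl
size-addToRow zero    w (row ∷ Z) = begin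
  size ((row ++ [ w ]) ∷ Z)         ≡⟨ size-∷ (row ++ [ w ]) Z ⟩
  length (row ++ [ w ]) + size Z    ≡⟨ cong (_+ size Z) (length-snoc row w) ⟩
  suc (length row + size Z)         ≡⟨ cong suc (size-∷ row Z) ⟨
  suc (size (row ∷ Z))              ∎
  where open ≡-Reasoning
size-addToRow (suc a) w (row ∷ Z) = begin
  size (row ∷ addToRow a w Z)          ≡⟨ size-∷ row (addToRow a w Z) ⟩
  length row + size (addToRow a w Z)   ≡⟨ cong (length row +_) (size-addToRow a w Z) ⟩
  length row + suc (size Z)            ≡⟨ +-suc (length row) (size Z) ⟩
  suc (length row + size Z)            ≡⟨ cong suc (size-∷ row Z) ⟨
  suc (size (row ∷ Z))                 ∎
  where open ≡-Reasoning


All-NonEmpty-addToRow : ∀ a w Z → All NonEmpty Z → All NonEmpty (addToRow a w Z)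
All-NonEmpty-addToRow a       w []        []       = (λ ()) ∷ []
All-NonEmpty-addToRow zero    w ([] ∷ Z)  (ne ∷ _) = ⊥-elim (ne refl)
All-NonEmpty-addToRow zero    w ((x ∷ xs) ∷ Z) (_ ∷ ps) = (λ ()) ∷ ps
All-NonEmpty-addToRow (suc a) w (row ∷ Z) (p ∷ ps) = p ∷ All-NonEmpty-addToRow a w Z ps

setRow-snoc : ∀ xs c v w → c < length xs → setRow (xs ++ [ w ]) c v ≡ setRow xs c v ++ [ w ]
setRow-snoc (x ∷ xs) zero    v w _         = refl
setRow-snoc (x ∷ xs) (suc c) v w (s≤s lt) = cong (x ∷_) (setRow-snoc xs c v w lt)

set-addToRow : ∀ a w Z r c v → c < rowLength Z r → set (addToRow a w Z) r c v ≡ addToRow a w (set Z r c v)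
set-addToRow zero    w (row ∷ Z) zero    c v lt = cong (_∷ Z) (setRow-snoc row c v w lt)
set-addToRow (suc a) w (row ∷ Z) zero    c v lt = refl
set-addToRow zero    w (row ∷ Z) (suc r) c v lt = refl
set-addToRow (suc a) w (row ∷ Z) (suc r) c v lt = cong (row ∷_) (set-addToRow a w Z r c v lt)

nothing≢just : ∀ {A : Set} {x : A} → nothing ≢ just x
nothing≢just ()

delRow-snoc-last : ∀ xs w → delRow (xs ++ [ w ]) (length xs) ≡ xs
delRow-snoc-last []       w = refl
delRow-snoc-last (x ∷ xs) w = cong (x ∷_) (delRow-snoc-last xs w)

delRow-set-snoc : ∀ xs c w → length xs ≡ suc c → delRow (setRow (xs ++ [ w ]) c w) (suc c) ≡ delRow xs c ++ [ w ]
delRow-set-snoc (x ∷ [])     zero    w _ = refl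
delRow-set-snoc (x ∷ y ∷ xs) zero    w ()
delRow-set-snoc (x ∷ xs)     (suc c) w e = cong (x ∷_) (delRow-set-snoc xs c w (suc-injective e))

setRow-last : ∀ xs c w → length xs ≡ suc c → setRow xs c w ≡ delRow xs c ++ [ w ]
setRow-last (x ∷ [])     zero    w _ = refl
setRow-last (x ∷ y ∷ xs) zero    w ()
setRow-last (x ∷ xs)     (suc c) w e = cong (x ∷_) (setRow-last xs c w (suc-injective e))

delRow-nil⇒0 : ∀ xs c → c < length xs → delRow xs c ≡ [] → c ≡ 0
delRow-nil⇒0 (x ∷ [])     zero    _         _  = refl
delRow-nil⇒0 (x ∷ y ∷ xs) zero    _         ()
delRow-nil⇒0 (x ∷ xs)     (suc c) _         ()

delCell-keepRow : ∀ row T c {x xs} → delRow row c ≡ x ∷ xs → delCell (row ∷ T) 0 c ≡ (x ∷ xs) ∷ T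
delCell-keepRow row T c e with delRow row c
delCell-keepRow row T c () | []
... | y ∷ ys = cong (_∷ T) e


rowLength-addToRow-0 : ∀ a w Z → All NonEmpty Z → 0 < rowLength (addToRow a w Z) 0
rowLength-addToRow-0 a       w []              _        = s≤s z≤n
rowLength-addToRow-0 zero    w ([] ∷ Z)        (ne ∷ _) = ⊥-elim (ne refl)
rowLength-addToRow-0 zero    w ((x ∷ xs) ∷ Z)  _        = s≤s z≤n
rowLength-addToRow-0 (suc a) w ([] ∷ Z)        (ne ∷ _) = ⊥-elim (ne refl)
rowLength-addToRow-0 (suc a) w ((x ∷ xs) ∷ Z)  _        = s≤s z≤n

delCell-addToRow : ∀ a w Z r c → All NonEmpty Z → c < rowLength Z r → r ≢ a →
  rowLength (addToRow a w Z) (suc r) ≤ c → delCell (addToRow a w Z) r c ≡ addToRow a w (delCell Z r c)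
delCell-addToRow zero    w Z         zero    c _        _  r≢a _ = ⊥-elim (r≢a refl)
delCell-addToRow (suc a) w (row ∷ Z) zero    c (_ ∷ ne) lt _   below with delRow row c in eq
... | []     = ⊥-elim (<⇒≱ (rowLength-addToRow-0 a w Z ne)
                             (subst (rowLength (addToRow a w Z) 0 ≤_) (delRow-nil⇒0 row c lt eq) below))
... | y ∷ ys = refl
delCell-addToRow zero    w (row ∷ Z) (suc r) c _        _  _   _ = refl
delCell-addToRow (suc a) w (row ∷ Z) (suc r) c (_ ∷ ne) lt r≢a below =
  cong (row ∷_) (delCell-addToRow a w Z r c ne lt (r≢a ∘ cong suc) below)

delCell-slidRight : ∀ a w Z c → All NonEmpty Z → rowLength Z a ≡ suc c → rowLength Z (suc a) ≤ c →
  delCell (set (addToRow a w Z) a c w) a (suc c) ≡ addToRow a w (delCell Z a c)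
delCell-slidRight zero w (row ∷ Z) c ne e below with delRow row c in eq
delCell-slidRight zero w (row ∷ []) c _ e below | [] =
  delCell-keepRow (setRow (row ++ [ w ]) c w) [] (suc c)
    (trans (delRow-set-snoc row c w e) (cong (_++ [ w ]) eq))
delCell-slidRight zero w (row ∷ row₁ ∷ Z) c (_ ∷ ne₁ ∷ _) e below | [] with delRow-nil⇒0 row c (≤-reflexive (sym e)) eq
delCell-slidRight zero w (row ∷ [] ∷ Z) .0 (_ ∷ ne₁ ∷ _) e below | [] | refl = ⊥-elim (ne₁ refl)
delCell-slidRight zero w (row ∷ (x ∷ xs) ∷ Z) .0 _ e () | [] | refl
delCell-slidRight zero w (row ∷ Z) c _ e below | y ∷ ys =
  delCell-keepRow (setRow (row ++ [ w ]) c w) Z (suc c)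
    (trans (delRow-set-snoc row c w e) (cong (_++ [ w ]) eq))
delCell-slidRight (suc a) w (row ∷ Z) c (_ ∷ ne) e below = cong (row ∷_) (delCell-slidRight a w Z c ne e below)

delCell-slidDown : ∀ r w Z c → All NonEmpty Z → rowLength Z r ≡ suc c → rowLength Z (suc r) ≡ c →
  delCell (set (addToRow (suc r) w Z) r c w) (suc r) c ≡ addToRow r w (delCell Z r c)
delCell-slidDown zero w ((u ∷ []) ∷ [])     zero _ _  _    = refl
delCell-slidDown zero w ((u ∷ x ∷ xs) ∷ []) zero _ () _
delCell-slidDown zero w (row ∷ [] ∷ Z)      c (_ ∷ ne₁ ∷ _) _ _ = ⊥-elim (ne₁ refl)
delCell-slidDown zero w (row ∷ (x ∷ xs) ∷ Z) c (_ ∷ _ ∷ _) e e₁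
  rewrite delCell-keepRow ((x ∷ xs) ++ [ w ]) Z c
            (trans (cong (delRow ((x ∷ xs) ++ [ w ])) (sym e₁)) (delRow-snoc-last (x ∷ xs) w))
  with delRow row c in eq
... | [] with delRow-nil⇒0 row c (≤-reflexive (sym e)) eq
...   | refl = ⊥-elim (1+n≢0 e₁)
delCell-slidDown zero w (row ∷ (x ∷ xs) ∷ Z) c _ e e₁ | y ∷ ys =
  cong (_∷ ((x ∷ xs) ∷ Z)) (trans (setRow-last row c w e) (cong (_++ [ w ]) eq))
delCell-slidDown (suc r) w (row ∷ Z) c (_ ∷ ne) e e₁ = cong (row ∷_) (delCell-slidDown r w Z c ne e e₁)

delCell-addToRow-new : ∀ a w Z → a ≤ length Z → All NonEmpty Z → delCell (addToRow a w Z) a (rowLength Z a) ≡ Z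
delCell-addToRow-new zero    w []             _         _        = refl
delCell-addToRow-new zero    w ([] ∷ Z)       _         (ne ∷ _) = ⊥-elim (ne refl)
delCell-addToRow-new zero    w ((x ∷ xs) ∷ Z) _         _        =
  delCell-keepRow ((x ∷ xs) ++ [ w ]) Z (length (x ∷ xs)) (delRow-snoc-last (x ∷ xs) w)
delCell-addToRow-new (suc a) w (row ∷ Z)      (s≤s al) (_ ∷ ne) = cong (row ∷_) (delCell-addToRow-new a w Z al ne)

-- Jeu de taquin slides

<⇒<ᵇ≡true : ∀ {x y} → x < y → (x <ᵇ y) ≡ true
<⇒<ᵇ≡true {zero}  {suc y} _         = refl
<⇒<ᵇ≡true {suc x} {suc y} (s≤s lt) = <⇒<ᵇ≡true lt

≥⇒<ᵇ≡false : ∀ {x y} → y ≤ x → (x <ᵇ y) ≡ false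
≥⇒<ᵇ≡false {x}     {zero}  _         = refl
≥⇒<ᵇ≡false {suc x} {suc y} (s≤s le) = ≥⇒<ᵇ≡false le

-- One step of Defs.slide with the hole at (r, c): the entry x at (r′, c′) moves into it.
data Move (T : Tableau) (r c : ℕ) : ℕ → ℕ → ℕ → Set where
  right : ∀ {x} → get T r (suc c) ≡ just x → (∀ {y} → get T (suc r) c ≡ just y → x < y) →
          Move T r c r (suc c) x
  down  : ∀ {y} → get T (suc r) c ≡ just y → (∀ {x} → get T r (suc c) ≡ just x → y ≤ x) →
          Move T r c (suc r) c y

Stuck : Tableau → ℕ → ℕ → Set
Stuck T r c = get T r (suc c) ≡ nothing × get T (suc r) c ≡ nothing

Move-source : ∀ {T r c r′ c′ x} → Move T r c r′ c′ x → get T r′ c′ ≡ just x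
Move-source (right gR _) = gR
Move-source (down gB _)  = gB

Move-source≢hole : ∀ {T r c r′ c′ x} → Move T r c r′ c′ x → r′ ≡ r → c′ ≢ c
Move-source≢hole {c = c} (right _ _) _    = λ e → <-irrefl (sym e) (n<1+n c)
Move-source≢hole {r = r} (down _ _)  r′≡r = ⊥-elim (<-irrefl (sym r′≡r) (n<1+n r))

slide-move : ∀ f {T r c r′ c′ x} → Move T r c r′ c′ x → slide (suc f) T r c ≡ slide f (set T r c x) r′ c′
slide-move f {T} {r} {c} (right {x} gR x<) = below (get T (suc r) c) refl
  where
  below : ∀ mB → get T (suc r) c ≡ mB → slide (suc f) T r c ≡ slide f (set T r c x) r (suc c)
  below nothing  gB rewrite gR | gB = refl
  below (just y) gB with x< gB
  ... | x<y rewrite gR | gB | <⇒<ᵇ≡true x<y = refl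
slide-move f {T} {r} {c} (down {y} gB y≤) = beside (get T r (suc c)) refl
  where
  beside : ∀ mR → get T r (suc c) ≡ mR → slide (suc f) T r c ≡ slide f (set T r c y) (suc r) c
  beside nothing  gR rewrite gR | gB = refl
  beside (just x) gR with y≤ gR
  ... | y≤x rewrite gR | gB | ≥⇒<ᵇ≡false y≤x = refl

slide-stuck : ∀ f T r c → Stuck T r c → slide f T r c ≡ delCell T r c
slide-stuck zero    T r c _         = refl
slide-stuck (suc f) T r c (gR , gB) rewrite gR | gB = refl

nextMove : ∀ T r c → Stuck T r c ⊎ ∃[ r′ ] ∃[ c′ ] ∃[ x ] Move T r c r′ c′ x
nextMove T r c = decide (get T r (suc c)) (get T (suc r) c) refl refl
  where
  decide : ∀ mR mB → get T r (suc c) ≡ mR → get T (suc r) c ≡ mB →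
    Stuck T r c ⊎ ∃[ r′ ] ∃[ c′ ] ∃[ x ] Move T r c r′ c′ x
  decide nothing  nothing  gR gB = inj₁ (gR , gB)
  decide (just x) nothing  gR gB = inj₂ (_ , _ , _ , right gR (⊥-elim ∘ nothing≢just ∘ trans (sym gB)))
  decide nothing  (just y) gR gB = inj₂ (_ , _ , _ , down gB (⊥-elim ∘ nothing≢just ∘ trans (sym gR)))
  decide (just x) (just y) gR gB with x <? y
  ... | yes x<y = inj₂ (_ , _ , _ , right gR λ gB′ → subst (x <_) (just-injective (trans (sym gB) gB′)) x<y)
  ... | no  x≮y = inj₂ (_ , _ , _ , down gB λ gR′ → subst (y ≤_) (just-injective (trans (sym gR) gR′)) (≮⇒≥ x≮y))

slide-preserves : (I : Tableau → ℕ → ℕ → Set) (P : Tableau → Set) →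
  (∀ {Z r c r′ c′ x} → Move Z r c r′ c′ x → I Z r c → I (set Z r c x) r′ c′) →
  (∀ {Z r c} → I Z r c → P (delCell Z r c)) →
  ∀ f {Z r c} → I Z r c → P (slide f Z r c)
slide-preserves I P step stop zero    inv = stop inv
slide-preserves I P step stop (suc f) {Z} {r} {c} inv with nextMove Z r c
... | inj₁ stuck = subst P (sym (slide-stuck (suc f) Z r c stuck)) (stop inv)
... | inj₂ (_ , _ , _ , m) = subst P (sym (slide-move f m)) (slide-preserves I P step stop f (step m inv))

AllBut : (ℕ → Set) → Tableau → ℕ → ℕ → Set
AllBut P Z r c = ∀ i j {v} → get Z i j ≡ just v → (i ≡ r × j ≡ c) ⊎ P v

getRow⇒All : ∀ {P : ℕ → Set} xs → (∀ j {v} → getRow xs j ≡ just v → P v) → All P xs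
getRow⇒All []       h = []
getRow⇒All (x ∷ xs) h = h zero refl ∷ getRow⇒All xs (λ j → h (suc j))

get⇒All : ∀ {P : ℕ → Set} T → (∀ i j {v} → get T i j ≡ just v → P v) → All (All P) T
get⇒All []        h = []
get⇒All (row ∷ T) h = getRow⇒All row (h zero) ∷ get⇒All T (λ i → h (suc i))

delRow-All : ∀ {P : ℕ → Set} xs c → (∀ j {v} → getRow xs j ≡ just v → j ≡ c ⊎ P v) → All P (delRow xs c)
delRow-All []       c       h = []
delRow-All (x ∷ xs) zero    h = getRow⇒All xs λ j e → Sum.fromInj₂ (λ ()) (h (suc j) e)
delRow-All (x ∷ xs) (suc c) h =
  Sum.fromInj₂ (λ ()) (h zero refl) ∷ delRow-All xs c λ j e → Sum.map₁ suc-injective (h (suc j) e)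

AllBut-lowerRows : ∀ {P : ℕ → Set} {row Z c} → AllBut P (row ∷ Z) zero c → All (All P) Z
AllBut-lowerRows {Z = Z} h = get⇒All Z λ i j e → Sum.fromInj₂ ((λ ()) ∘ proj₁) (h (suc i) j e)

delCell-All : ∀ {P : ℕ → Set} Z r c → AllBut P Z r c → All (All P) (delCell Z r c)
delCell-All []        r       c h = []
delCell-All (row ∷ Z) zero    c h with delRow row c | delRow-All row c (λ j e → Sum.map₁ proj₂ (h zero j e))
... | []     | _   = AllBut-lowerRows h
... | y ∷ ys | row′ = row′ ∷ AllBut-lowerRows h
delCell-All (row ∷ Z) (suc r) c h =
  getRow⇒All row (λ j e → Sum.fromInj₂ ((λ ()) ∘ proj₁) (h zero j e)) ∷
  delCell-All Z r c (λ i j e → Sum.map₁ (Product.map₁ suc-injective) (h (suc i) j e))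

AllBut-move : ∀ {P : ℕ → Set} {Z r c r′ c′ x} → Move Z r c r′ c′ x → AllBut P Z r c → AllBut P (set Z r c x) r′ c′
AllBut-move {P} {Z} {r} {c} {r′} {c′} {x} m h i j e with h r′ c′ (Move-source m)
... | inj₁ (r′≡r , c′≡c) = ⊥-elim (Move-source≢hole m r′≡r c′≡c)
... | inj₂ Px with get-set-inv Z r c x i j e
...   | inj₁ refl = inj₂ Px
...   | inj₂ old with h i j old
...     | inj₂ Pv            = inj₂ Pv
...     | inj₁ (refl , refl) = inj₂ (subst P (just-injective (trans (sym (get-set-same Z r c x (get-just⇒< Z r c old))) e)) Px)

slide-All : ∀ {P : ℕ → Set} f Z r c → AllBut P Z r c → All (All P) (slide f Z r c)
slide-All {P} f Z r c = slide-preserves (AllBut P) (All (All P)) AllBut-move (λ {Z} {r} {c} → delCell-All Z r c) f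

delCell-All-NonEmpty : ∀ Z r c → All NonEmpty Z → All NonEmpty (delCell Z r c)
delCell-All-NonEmpty []        r       c []       = []
delCell-All-NonEmpty (row ∷ Z) zero    c (_ ∷ ne) with delRow row c
... | []     = ne
... | y ∷ ys = (λ ()) ∷ ne
delCell-All-NonEmpty (row ∷ Z) (suc r) c (p ∷ ne) = p ∷ delCell-All-NonEmpty Z r c ne

slide-All-NonEmpty : ∀ f Z r c → All NonEmpty Z → All NonEmpty (slide f Z r c)
slide-All-NonEmpty f Z r c =
  slide-preserves (λ Z _ _ → All NonEmpty Z) (All NonEmpty)
    (λ {Z} {r} {c} {_} {_} {x} _ → All-NonEmpty-set Z r c x) (λ {Z} {r} {c} → delCell-All-NonEmpty Z r c) f

delRow-length≤ : ∀ xs c → length (delRow xs c) ≤ length xs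
delRow-length≤ []       c       = z≤n
delRow-length≤ (x ∷ xs) zero    = n≤1+n _
delRow-length≤ (x ∷ xs) (suc c) = s≤s (delRow-length≤ xs c)

rowLength-delCell≤ : ∀ Z r c → Young Z → ∀ i → rowLength (delCell Z r c) i ≤ rowLength Z i
rowLength-delCell≤ []        r       c young i = z≤n
rowLength-delCell≤ (row ∷ Z) zero    c young i with delRow row c in eq
... | []     = young i
rowLength-delCell≤ (row ∷ Z) zero    c young zero    | y ∷ ys = subst (_≤ length row) (cong length eq) (delRow-length≤ row c)
rowLength-delCell≤ (row ∷ Z) zero    c young (suc i) | y ∷ ys = ≤-refl
rowLength-delCell≤ (row ∷ Z) (suc r) c young zero    = ≤-refl
rowLength-delCell≤ (row ∷ Z) (suc r) c young (suc i) = rowLength-delCell≤ Z r c (Young-tail young) i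

slide-rowLength≤ : ∀ f Z r c → Young Z → ∀ i → rowLength (slide f Z r c) i ≤ rowLength Z i
slide-rowLength≤ f Z r c young =
  slide-preserves SameShape (λ T → ∀ i → rowLength T i ≤ rowLength Z i)
    (λ {Z′} {r} {c} {_} {_} {x} _ same i → trans (rowLength-set Z′ r c x i) (same i))
    (λ {Z′} {r} {c} same i → ≤-trans (rowLength-delCell≤ Z′ r c (youngLike Z′ same) i) (≤-reflexive (same i)))
    f (λ _ → refl)
  where
  SameShape : Tableau → ℕ → ℕ → Set
  SameShape Z′ _ _ = ∀ i → rowLength Z′ i ≡ rowLength Z i
  youngLike : ∀ Z′ → (∀ i → rowLength Z′ i ≡ rowLength Z i) → Young Z′
  youngLike Z′ same i = subst₂ _≤_ (sym (same (suc i))) (sym (same i)) (young i)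

EntriesLess : ℕ → Tableau → Set
EntriesLess w Z = ∀ i j {v} → get Z i j ≡ just v → v < w

EntriesLess-set : ∀ w Z r c x → EntriesLess w Z → x < w → EntriesLess w (set Z r c x)
EntriesLess-set w Z r c x bd x<w i j e with get-set-inv Z r c x i j e
... | inj₁ refl = x<w
... | inj₂ e′   = bd i j e′

Move-diagonal : ∀ {T r c r′ c′ x} → Move T r c r′ c′ x → r′ + c′ ≡ suc (r + c)
Move-diagonal {r = r} {c} (right _ _) = +-suc r c
Move-diagonal             (down _ _)  = refl

Move-inRow : ∀ {T r c r′ c′ x} → Move T r c r′ c′ x → c′ < rowLength T r′
Move-inRow {T} {r′ = r′} {c′} m = get-just⇒< T r′ c′ (Move-source m)

Move-fuel : ∀ f {Z r c r′ c′ x} → All NonEmpty Z → Move Z r c r′ c′ x → size Z ≤ suc (f + (r + c)) →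
  ∃[ f′ ] f ≡ suc f′ × size Z ≤ suc (f′ + (r′ + c′))
Move-fuel zero {Z} {r′ = r′} {c′} ne m fuel =
  ⊥-elim (<⇒≱ (subst (_< size Z) (Move-diagonal m) (get-just⇒<size Z r′ c′ ne (Move-source m))) fuel)
Move-fuel (suc f) {Z} {r} {c} {r′} {c′} ne m fuel = f , refl , (begin
  size Z                   ≤⟨ fuel ⟩
  suc (suc f + (r + c))    ≡⟨ cong suc (+-suc f (r + c)) ⟨
  suc (f + suc (r + c))    ≡⟨ cong (λ k → suc (f + k)) (Move-diagonal m) ⟨
  suc (f + (r′ + c′))      ∎)
  where open ≤-Reasoning

Move-addToRow : ∀ a w {Z r c r′ c′ x} → a ≤ length Z → EntriesLess w Z →
  Move Z r c r′ c′ x → Move (addToRow a w Z) r c r′ c′ x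
Move-addToRow a w {Z} {r} {c} al bd (right gR x<) = right (get-addToRow-old a w Z r (suc c) al gR) x<′
  where
  x<′ : ∀ {y} → get (addToRow a w Z) (suc r) c ≡ just y → _
  x<′ gB with get-addToRow-just a w Z (suc r) c al gB
  ... | inj₁ gB′              = x< gB′
  ... | inj₂ (_ , _ , refl)   = bd r (suc c) gR
Move-addToRow a w {Z} {r} {c} al bd (down gB y≤) = down (get-addToRow-old a w Z (suc r) c al gB) y≤′
  where
  y≤′ : ∀ {x} → get (addToRow a w Z) r (suc c) ≡ just x → _
  y≤′ gR with get-addToRow-just a w Z r (suc c) al gR
  ... | inj₁ gR′              = y≤ gR′
  ... | inj₂ (_ , _ , refl)   = <⇒≤ (bd (suc r) c gB)

rowLength-atEnd : ∀ Z r c → c < rowLength Z r → get Z r (suc c) ≡ nothing → rowLength Z r ≡ suc c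
rowLength-atEnd Z r c hole gR = ≤-antisym (get-nothing⇒≤ Z r (suc c) gR) hole

slide-addToRow-right : ∀ f Z a c w → All NonEmpty Z → a ≤ length Z →
  rowLength Z a ≡ suc c → get Z (suc a) c ≡ nothing →
  slide (suc f) (addToRow a w Z) a c ≡ addToRow a w (delCell Z a c)
slide-addToRow-right f Z a c w ne al atEnd gB = begin
  slide (suc f) Y a c               ≡⟨ slide-move f (right wRight (⊥-elim ∘ nothing≢just ∘ trans (sym yB))) ⟩
  slide f (set Y a c w) a (suc c)   ≡⟨ slide-stuck f (set Y a c w) a (suc c) (endOfRow , nothingBelow) ⟩
  delCell (set Y a c w) a (suc c)   ≡⟨ delCell-slidRight a w Z c ne atEnd (get-nothing⇒≤ Z (suc a) c gB) ⟩
  addToRow a w (delCell Z a c)      ∎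
  where
  open ≡-Reasoning
  Y = addToRow a w Z
  wRight : get Y a (suc c) ≡ just w
  wRight = subst (λ k → get Y a k ≡ just w) atEnd (get-addToRow-new a w Z al)
  yB : get Y (suc a) c ≡ nothing
  yB = trans (get-addToRow-otherRow a w Z (suc a) c al 1+n≢n) gB
  endOfRow : get (set Y a c w) a (suc (suc c)) ≡ nothing
  endOfRow = ≤⇒get-nothing (set Y a c w) a (suc (suc c)) (≤-reflexive (begin
    rowLength (set Y a c w) a   ≡⟨ rowLength-set Y a c w a ⟩
    rowLength Y a               ≡⟨ rowLength-addToRow-same a w Z al ⟩
    suc (rowLength Z a)         ≡⟨ cong suc atEnd ⟩
    suc (suc c)                 ∎))
  nothingBelow : get (set Y a c w) (suc a) (suc c) ≡ nothing
  nothingBelow = ≤⇒get-nothing (set Y a c w) (suc a) (suc c)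
    (≤-trans (≤-reflexive (trans (rowLength-set Y a c w (suc a)) (rowLength-addToRow-other a w Z (suc a) al 1+n≢n)))
             (m≤n⇒m≤1+n (get-nothing⇒≤ Z (suc a) c gB)))

slide-addToRow-below : ∀ f Z r c w → All NonEmpty Z → Young Z → suc r ≤ length Z →
  rowLength Z r ≡ suc c → rowLength Z (suc r) ≡ c →
  slide (suc f) (addToRow (suc r) w Z) r c ≡ addToRow r w (delCell Z r c)
slide-addToRow-below f Z r c w ne young al atEnd shorter = begin
  slide (suc f) Y r c               ≡⟨ slide-move f (down wBelow (⊥-elim ∘ nothing≢just ∘ trans (sym yR))) ⟩
  slide f (set Y r c w) (suc r) c   ≡⟨ slide-stuck f (set Y r c w) (suc r) c (endOfRow , nothingBelow) ⟩
  delCell (set Y r c w) (suc r) c   ≡⟨ delCell-slidDown r w Z c ne atEnd shorter ⟩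
  addToRow r w (delCell Z r c)      ∎
  where
  open ≡-Reasoning
  Y = addToRow (suc r) w Z
  wBelow : get Y (suc r) c ≡ just w
  wBelow = subst (λ k → get Y (suc r) k ≡ just w) shorter (get-addToRow-new (suc r) w Z al)
  yR : get Y r (suc c) ≡ nothing
  yR = trans (get-addToRow-otherRow (suc r) w Z r (suc c) al (1+n≢n ∘ sym)) (≤⇒get-nothing Z r (suc c) (≤-reflexive atEnd))
  endOfRow : get (set Y r c w) (suc r) (suc c) ≡ nothing
  endOfRow = ≤⇒get-nothing (set Y r c w) (suc r) (suc c) (≤-reflexive (begin
    rowLength (set Y r c w) (suc r)   ≡⟨ rowLength-set Y r c w (suc r) ⟩
    rowLength Y (suc r)               ≡⟨ rowLength-addToRow-same (suc r) w Z al ⟩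
    suc (rowLength Z (suc r))         ≡⟨ cong suc shorter ⟩
    suc c                             ∎))
  nothingBelow : get (set Y r c w) (suc (suc r)) c ≡ nothing
  nothingBelow = ≤⇒get-nothing (set Y r c w) (suc (suc r)) c
    (≤-trans (≤-reflexive (trans (rowLength-set Y r c w (suc (suc r))) (rowLength-addToRow-other (suc r) w Z (suc (suc r)) al 1+n≢n)))
             (subst (rowLength Z (suc (suc r)) ≤_) shorter (young (suc r))))

slide-addToRow-stuck : ∀ f Z r c a w → All NonEmpty Z → Young Z → a ≤ length Z →
  c < rowLength Z r → Stuck Z r c →
  ∃[ a′ ] slide (suc f) (addToRow a w Z) r c ≡ addToRow a′ w (delCell Z r c)
slide-addToRow-stuck f Z r c a w ne young al hole (gR , gB)
  with get-addToRow a w Z r (suc c) al | get-addToRow a w Z (suc r) c al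
... | inj₂ (refl , _) | inj₂ (1+r≡r , _) = ⊥-elim (1+n≢n 1+r≡r)
... | inj₂ (refl , e) | inj₁ _           = r , slide-addToRow-right f Z r c w ne al (sym e) gB
... | inj₁ _          | inj₂ (refl , e)  = r , slide-addToRow-below f Z r c w ne young al (rowLength-atEnd Z r c hole gR) (sym e)
... | inj₁ eR         | inj₁ eB          = a , (begin
  slide (suc f) Y r c            ≡⟨ slide-stuck (suc f) Y r c (trans eR gR , trans eB gB) ⟩
  delCell Y r c                  ≡⟨ delCell-addToRow a w Z r c ne hole r≢a (get-nothing⇒≤ Y (suc r) c (trans eB gB)) ⟩
  addToRow a w (delCell Z r c)   ∎)
  where
  open ≡-Reasoning
  Y = addToRow a w Z
  r≢a : r ≢ a
  r≢a refl = nothing≢just (begin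
    nothing                      ≡⟨ trans eR gR ⟨
    get Y r (suc c)              ≡⟨ cong (get Y r) (rowLength-atEnd Z r c hole gR) ⟨
    get Y r (rowLength Z r)      ≡⟨ get-addToRow-new r w Z al ⟩
    just w                       ∎)

-- As w exceeds every entry, the slide makes the same moves in addToRow a w Z as in Z,
-- except that w may fill the last hole.  The fuel bound is kept by every move,
-- which raises r + c by one, and holds initially for f = size Z.
slide-addToRow : ∀ f Z r c a w → All NonEmpty Z → Young Z → a ≤ length Z → EntriesLess w Z →
  size Z ≤ suc (f + (r + c)) → c < rowLength Z r →
  ∃[ a′ ] slide (suc f) (addToRow a w Z) r c ≡ addToRow a′ w (slide f Z r c)
slide-addToRow f Z r c a w ne young al bd fuel hole with nextMove Z r c
... | inj₁ stuck with slide-addToRow-stuck f Z r c a w ne young al hole stuck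
...   | a′ , eq = a′ , trans eq (cong (addToRow a′ w) (sym (slide-stuck f Z r c stuck)))
slide-addToRow f Z r c a w ne young al bd fuel hole | inj₂ (r′ , c′ , x , m) with Move-fuel f ne m fuel
...   | f′ , refl , fuel′ with slide-addToRow f′ (set Z r c x) r′ c′ a w
          (All-NonEmpty-set Z r c x ne) (Young-set Z r c x young)
          (subst (a ≤_) (sym (length-set Z r c x)) al)
          (EntriesLess-set w Z r c x bd (bd r′ c′ (Move-source m)))
          (subst (_≤ suc (f′ + (r′ + c′))) (sym (size-set Z r c x)) fuel′)
          (subst (c′ <_) (sym (rowLength-set Z r c x r′)) (Move-inRow m))
...     | a′ , ih = a′ , (begin
  slide (suc f) Y r c                                  ≡⟨ slide-move f (Move-addToRow a w al bd m) ⟩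
  slide f (set Y r c x) r′ c′                          ≡⟨ cong (λ T → slide f T r′ c′) (set-addToRow a w Z r c x hole) ⟩
  slide (suc f′) (addToRow a w (set Z r c x)) r′ c′    ≡⟨ ih ⟩
  addToRow a′ w (slide f′ (set Z r c x) r′ c′)         ≡⟨ cong (addToRow a′ w) (slide-move f′ m) ⟨
  addToRow a′ w (slide f Z r c)                        ∎)
  where
  open ≡-Reasoning
  Y = addToRow a w Z

-- Tableaux grown one largest entry at a time

Addable : ℕ → Tableau → Set
Addable zero    X = ⊤
Addable (suc a) X = rowLength X (suc a) < rowLength X a

data Built : ℕ → Tableau → Set where
  []   : Built 0 []
  grow : ∀ {n X} a → Built n X → a ≤ length X → Addable a X → Built (suc n) (addToRow a (suc n) X)

Unique : Tableau → Set
Unique X = ∀ {i j i′ j′ v} → get X i j ≡ just v → get X i′ j′ ≡ just v → i ≡ i′ × j ≡ j′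

record Invariants (n : ℕ) (X : Tableau) : Set where
  field
    nonEmpty : All NonEmpty X
    young    : Young X
    unique   : Unique X
    range    : ∀ {i j v} → get X i j ≡ just v → 1 ≤ v × v ≤ n
    complete : ∀ {m} → 1 ≤ m → m ≤ n → ∃[ i ] ∃[ j ] get X i j ≡ just m
    size≡    : size X ≡ n

  bounded : ∀ {i j v} → get X i j ≡ just v → v ≤ n
  bounded = proj₂ ∘ range

  minus-isOneMinor : ∀ {i j v} → get X i j ≡ just v → IsOneMinor n X (X minus v)
  minus-isOneMinor e = _ , proj₁ (range e) , proj₂ (range e) , refl

Invariants-[] : Invariants 0 []
Invariants-[] = record
  { nonEmpty = []
  ; young    = λ _ → z≤n
  ; unique   = λ ()
  ; range    = λ ()
  ; complete = λ 1≤m m≤0 → ⊥-elim (<⇒≱ 1≤m m≤0)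
  ; size≡    = refl
  }

Young-addToRow : ∀ a w X → a ≤ length X → Young X → Addable a X → Young (addToRow a w X)
Young-addToRow a w X al young addable i with suc i ≟ a | i ≟ a
... | yes refl | yes i≡1+i = ⊥-elim (1+n≢n (sym i≡1+i))
... | yes refl | no i≢a = subst₂ _≤_ (sym (rowLength-addToRow-same a w X al))
                                     (sym (rowLength-addToRow-other a w X i al i≢a)) addable
... | no 1+i≢a | yes refl = subst₂ _≤_ (sym (rowLength-addToRow-other a w X (suc i) al 1+i≢a))
                                       (sym (rowLength-addToRow-same a w X al)) (m≤n⇒m≤1+n (young i))
... | no 1+i≢a | no i≢a = subst₂ _≤_ (sym (rowLength-addToRow-other a w X (suc i) al 1+i≢a))
                                     (sym (rowLength-addToRow-other a w X i al i≢a)) (young i)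

Invariants-grow : ∀ {n X} a → Invariants n X → a ≤ length X → Addable a X → Invariants (suc n) (addToRow a (suc n) X)
Invariants-grow {n} {X} a inv al addable = record
  { nonEmpty = All-NonEmpty-addToRow a (suc n) X nonEmpty
  ; young    = Young-addToRow a (suc n) X al young addable
  ; unique   = unique′
  ; range    = range′
  ; complete = complete′
  ; size≡    = trans (size-addToRow a (suc n) X) (cong suc size≡)
  }
  where
  open Invariants inv
  range′ : ∀ {i j v} → get (addToRow a (suc n) X) i j ≡ just v → 1 ≤ v × v ≤ suc n
  range′ {i} {j} e with get-addToRow-just a (suc n) X i j al e
  ... | inj₁ old             = proj₁ (range old) , m≤n⇒m≤1+n (bounded old)
  ... | inj₂ (_ , _ , refl)  = s≤s z≤n , ≤-refl
  unique′ : Unique (addToRow a (suc n) X)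
  unique′ {i} {j} {i′} {j′} e e′ with get-addToRow-just a (suc n) X i j al e | get-addToRow-just a (suc n) X i′ j′ al e′
  ... | inj₁ old | inj₁ old′                          = unique old old′
  ... | inj₂ (refl , refl , _) | inj₂ (refl , refl , _) = refl , refl
  ... | inj₁ old | inj₂ (_ , _ , refl)                = ⊥-elim (1+n≰n (bounded old))
  ... | inj₂ (_ , _ , refl) | inj₁ old′               = ⊥-elim (1+n≰n (bounded old′))
  complete′ : ∀ {m} → 1 ≤ m → m ≤ suc n → ∃[ i ] ∃[ j ] get (addToRow a (suc n) X) i j ≡ just m
  complete′ {m} 1≤m m≤1+n with m ≟ suc n
  ... | yes refl = a , rowLength X a , get-addToRow-new a (suc n) X al
  ... | no m≢1+n with complete 1≤m (≤-pred (≤∧≢⇒< m≤1+n m≢1+n))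
  ...   | i , j , e = i , j , get-addToRow-old a (suc n) X i j al e

Built⇒Invariants : ∀ {n X} → Built n X → Invariants n X
Built⇒Invariants []                      = Invariants-[]
Built⇒Invariants (grow a b al addable) = Invariants-grow a (Built⇒Invariants b) al addable

findRow-sound : ∀ xs m {c} → findRow xs m ≡ just c → getRow xs c ≡ just m
findRow-sound (x ∷ xs) m e with x ≟ m
findRow-sound (x ∷ xs) m refl | yes refl = refl
... | no _ with findRow xs m in eq
findRow-sound (x ∷ xs) m refl | no _ | just c = findRow-sound xs m eq

find-sound : ∀ T m {r c} → find T m ≡ just (r , c) → get T r c ≡ just m
find-sound (row ∷ T) m e with findRow row m in eq
find-sound (row ∷ T) m refl | just c = findRow-sound row m eq
... | nothing with find T m in eq′
find-sound (row ∷ T) m refl | nothing | just (r , c) = find-sound T m eq′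

findRow-complete : ∀ xs m j → getRow xs j ≡ just m → ∃[ c ] findRow xs m ≡ just c
findRow-complete (x ∷ xs) m j e with x ≟ m
... | yes _ = zero , refl
findRow-complete (x ∷ xs) m zero    refl | no x≢x = ⊥-elim (x≢x refl)
findRow-complete (x ∷ xs) m (suc j) e    | no _ with findRow xs m | findRow-complete xs m j e
... | just c | _ = suc c , refl

find-complete : ∀ T m i j → get T i j ≡ just m → ∃[ p ] find T m ≡ just p
find-complete (row ∷ T) m zero j e with findRow row m | findRow-complete row m j e
... | just c | _ = (zero , c) , refl
find-complete (row ∷ T) m (suc i) j e with findRow row m
... | just c = (zero , c) , refl
... | nothing with find T m | find-complete T m i j e
...   | just (r , c) | _ = (suc r , c) , refl

find-unique : ∀ T m {i j} → Unique T → get T i j ≡ just m → find T m ≡ just (i , j)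
find-unique T m {i} {j} unique e with find-complete T m i j e
... | (r , c) , f with unique (find-sound T m f) e
...   | refl , refl = f

minus-at : ∀ T m {r c} → Unique T → get T r c ≡ just m → T minus m ≡ renumber m (slide (size T) T r c)
minus-at T m unique e rewrite find-unique T m unique e = refl

shift : ℕ → ℕ → ℕ
shift m p = if m <ᵇ p then p ∸ 1 else p

shift-≤ : ∀ {m v} → v ≤ m → shift m v ≡ v
shift-≤ v≤m rewrite ≥⇒<ᵇ≡false v≤m = refl

shift-suc : ∀ {m v} → m ≤ v → shift m (suc v) ≡ v
shift-suc m≤v rewrite <⇒<ᵇ≡true (s≤s m≤v) = refl

shift-≢ : ∀ {m n v} → m ≤ n → v ≤ n → v ≢ m → shift m v ≢ n
shift-≢ {m} {n} {v} m≤n v≤n v≢m with v ≤? m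
... | yes v≤m = subst (_≢ n) (sym (shift-≤ v≤m)) λ v≡n → v≢m (≤-antisym v≤m (subst (m ≤_) (sym v≡n) m≤n))
shift-≢ {v = zero}  _ _   _ | no v≰m = ⊥-elim (v≰m z≤n)
shift-≢ {v = suc v} _ v≤n _ | no v≰m =
  subst (_≢ _) (sym (shift-suc (≤-pred (≰⇒> v≰m)))) λ v≡n → 1+n≰n (subst (suc v ≤_) (sym v≡n) v≤n)

map-map-addToRow : ∀ (f : ℕ → ℕ) a w Z → map (map f) (addToRow a w Z) ≡ addToRow a (f w) (map (map f) Z)
map-map-addToRow f a       w []        = refl
map-map-addToRow f zero    w (row ∷ Z) = cong (_∷ map (map f) Z) (map-++ f row [ w ])
map-map-addToRow f (suc a) w (row ∷ Z) = cong (map f row ∷_) (map-map-addToRow f a w Z)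

rowLength-map-map : ∀ (f : ℕ → ℕ) Z i → rowLength (map (map f) Z) i ≡ rowLength Z i
rowLength-map-map f []        i       = refl
rowLength-map-map f (row ∷ Z) zero    = length-map f row
rowLength-map-map f (row ∷ Z) (suc i) = rowLength-map-map f Z i

All-NonEmpty-map-map : ∀ (f : ℕ → ℕ) Z → All NonEmpty Z → All NonEmpty (map (map f) Z)
All-NonEmpty-map-map f []             []       = []
All-NonEmpty-map-map f ([] ∷ Z)       (ne ∷ _) = ⊥-elim (ne refl)
All-NonEmpty-map-map f ((x ∷ xs) ∷ Z) (_ ∷ ne) = (λ ()) ∷ All-NonEmpty-map-map f Z ne

All²-map : ∀ {P : ℕ → Set} (f : ℕ → ℕ) {Z} → All (All (P ∘ f)) Z → All (All P) (map (map f) Z)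
All²-map f = All.map⁺ ∘ All.map All.map⁺

removeAll : ℕ → List ℕ → List ℕ
removeAll w = filter (λ x → ¬? (x ≟ w))

erase : ℕ → Tableau → Tableau
erase w []        = []
erase w (row ∷ T) with removeAll w row
... | []     = erase w T
... | y ∷ ys = (y ∷ ys) ∷ erase w T

erase-keep : ∀ w row T {y ys} → removeAll w row ≡ y ∷ ys → erase w (row ∷ T) ≡ (y ∷ ys) ∷ erase w T
erase-keep w row T e with removeAll w row
erase-keep w row T () | []
... | _ ∷ _ = cong (_∷ erase w T) e

erase-drop : ∀ w row T → removeAll w row ≡ [] → erase w (row ∷ T) ≡ erase w T
erase-drop w row T e with removeAll w row
... | [] = refl
erase-drop w row T () | _ ∷ _

removeAll-snoc : ∀ w xs → All (_≢ w) xs → removeAll w (xs ++ [ w ]) ≡ xs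
removeAll-snoc w xs ≢w = begin
  removeAll w (xs ++ [ w ])            ≡⟨ filter-++ (λ x → ¬? (x ≟ w)) xs [ w ] ⟩
  removeAll w xs ++ removeAll w [ w ]  ≡⟨ cong₂ _++_ (filter-all (λ x → ¬? (x ≟ w)) ≢w) (filter-reject (λ x → ¬? (x ≟ w)) (λ w≢w → w≢w refl)) ⟩
  xs ++ []                             ≡⟨ ++-identityʳ xs ⟩
  xs                                   ∎
  where open ≡-Reasoning

erase-id : ∀ w Z → All (All (_≢ w)) Z → All NonEmpty Z → erase w Z ≡ Z
erase-id w []             []         []      = refl
erase-id w ([] ∷ Z)       _          (ne ∷ _) = ⊥-elim (ne refl)
erase-id w ((x ∷ xs) ∷ Z) (≢w ∷ ≢ws) (_ ∷ ne) =
  trans (erase-keep w (x ∷ xs) Z (filter-all (λ x → ¬? (x ≟ w)) ≢w)) (cong ((x ∷ xs) ∷_) (erase-id w Z ≢ws ne))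

erase-addToRow : ∀ w a Z → All (All (_≢ w)) Z → All NonEmpty Z → erase w (addToRow a w Z) ≡ Z
erase-addToRow w a       []             []         []       = erase-drop w [ w ] [] (removeAll-snoc w [] [])
erase-addToRow w a       ([] ∷ Z)       _          (ne ∷ _) = ⊥-elim (ne refl)
erase-addToRow w zero    ((x ∷ xs) ∷ Z) (≢w ∷ ≢ws) (_ ∷ ne) =
  trans (erase-keep w ((x ∷ xs) ++ [ w ]) Z (removeAll-snoc w (x ∷ xs) ≢w)) (cong ((x ∷ xs) ∷_) (erase-id w Z ≢ws ne))
erase-addToRow w (suc a) ((x ∷ xs) ∷ Z) (≢w ∷ ≢ws) (_ ∷ ne) =
  trans (erase-keep w (x ∷ xs) (addToRow a w Z) (filter-all (λ x → ¬? (x ≟ w)) ≢w)) (cong ((x ∷ xs) ∷_) (erase-addToRow w a Z ≢ws ne))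

minus-rowLength≤ : ∀ Y k → Young Y → ∀ i → rowLength (Y minus k) i ≤ rowLength Y i
minus-rowLength≤ Y k young i with find Y k
... | nothing      = ≤-refl
... | just (r , c) = ≤-trans (≤-reflexive (rowLength-map-map (shift k) (slide (size Y) Y r c) i))
                             (slide-rowLength≤ (size Y) Y r c young i)

-- Removing the largest entry commutes with taking 1-minors

addToRow-minus-new : ∀ {n X} a → Invariants n X → a ≤ length X → Addable a X → addToRow a (suc n) X minus suc n ≡ X
addToRow-minus-new {n} {X} a inv al addable = begin
  Y minus suc n                             ≡⟨ minus-at Y (suc n) (Invariants.unique invY) (get-addToRow-new a (suc n) X al) ⟩
  renumber (suc n) (slide (size Y) Y a ℓ)   ≡⟨ cong (renumber (suc n)) (slide-stuck (size Y) Y a ℓ (endOfRow , nothingBelow)) ⟩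
  renumber (suc n) (delCell Y a ℓ)          ≡⟨ cong (renumber (suc n)) (delCell-addToRow-new a (suc n) X al nonEmpty) ⟩
  renumber (suc n) X                        ≡⟨ map-id-local (All.map (map-id-local ∘ All.map (shift-≤ ∘ m≤n⇒m≤1+n)) (get⇒All X λ _ _ → bounded)) ⟩
  X                                         ∎
  where
  open ≡-Reasoning
  open Invariants inv
  Y = addToRow a (suc n) X
  ℓ = rowLength X a
  invY = Invariants-grow a inv al addable
  endOfRow : get Y a (suc ℓ) ≡ nothing
  endOfRow = ≤⇒get-nothing Y a (suc ℓ) (≤-reflexive (rowLength-addToRow-same a (suc n) X al))
  nothingBelow : get Y (suc a) ℓ ≡ nothing
  nothingBelow = ≤⇒get-nothing Y (suc a) ℓ
    (≤-trans (≤-reflexive (rowLength-addToRow-other a (suc n) X (suc a) al 1+n≢n)) (young a))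

erase-minus-addToRow : ∀ {n X} a m → Invariants n X → a ≤ length X → Addable a X → 1 ≤ m → m ≤ n →
  erase n (addToRow a (suc n) X minus m) ≡ X minus m
erase-minus-addToRow {n} {X} a m inv al addable 1≤m m≤n with Invariants.complete inv 1≤m m≤n
... | i , j , m∈X = begin
  erase n (Y minus m)                                         ≡⟨ cong (erase n) (minus-at Y m (Invariants.unique invY) (get-addToRow-old a (suc n) X i j al m∈X)) ⟩
  erase n (renumber m (slide (size Y) Y i j))                 ≡⟨ cong (λ f → erase n (renumber m (slide f Y i j))) (size-addToRow a (suc n) X) ⟩
  erase n (renumber m (slide (suc (size X)) Y i j))           ≡⟨ cong (erase n ∘ renumber m) (proj₂ slid) ⟩
  erase n (renumber m (addToRow a′ (suc n) R))                ≡⟨ cong (erase n) (map-map-addToRow (shift m) a′ (suc n) R) ⟩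
  erase n (addToRow a′ (shift m (suc n)) (renumber m R))      ≡⟨ cong (λ k → erase n (addToRow a′ k (renumber m R))) (shift-suc m≤n) ⟩
  erase n (addToRow a′ n (renumber m R))                      ≡⟨ erase-addToRow n a′ (renumber m R) entries≢n
                                                                   (All-NonEmpty-map-map (shift m) R (slide-All-NonEmpty (size X) X i j nonEmpty)) ⟩
  renumber m R                                                ≡⟨ minus-at X m unique m∈X ⟨
  X minus m                                                   ∎
  where
  open ≡-Reasoning
  open Invariants inv
  Y = addToRow a (suc n) X
  invY = Invariants-grow a inv al addable
  R = slide (size X) X i j
  slid = slide-addToRow (size X) X i j a (suc n) nonEmpty young al (λ _ _ → s≤s ∘ bounded)
           (≤-trans (n≤1+n _) (s≤s (m≤m+n _ _))) (get-just⇒< X i j m∈X)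
  a′ = proj₁ slid
  survivors : AllBut (λ v → v ≤ n × v ≢ m) X i j
  survivors i′ j′ {v} e with v ≟ m
  ... | yes refl = inj₁ (unique e m∈X)
  ... | no v≢m   = inj₂ (bounded e , v≢m)
  entries≢n : All (All (_≢ n)) (renumber m R)
  entries≢n = All²-map (shift m) (All.map (All.map λ (v≤n , v≢m) → shift-≢ m≤n v≤n v≢m) (slide-All (size X) X i j survivors))

erase-largest : ∀ {n X} → Built n X → 1 ≤ n → erase n X ≡ X minus n
erase-largest {suc n} (grow {X = X} a b al addable) _ = begin
  erase (suc n) (addToRow a (suc n) X)          ≡⟨ erase-addToRow (suc n) a X (All.map (All.map (<⇒≢ ∘ s≤s)) (get⇒All X λ _ _ → bounded)) nonEmpty ⟩
  X                                             ≡⟨ addToRow-minus-new a inv al addable ⟨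
  addToRow a (suc n) X minus suc n              ∎
  where
  open ≡-Reasoning
  inv = Built⇒Invariants b
  open Invariants inv

record Minors⊆ (n : ℕ) (T T′ : Tableau) : Set where
  constructor minors⊆
  field included : ∀ {S} → IsOneMinor n T S → IsOneMinor n T′ S
open Minors⊆

erase-minor : ∀ {n X} a → Built n X → a ≤ length X → Addable a X → 1 ≤ n →
  ∀ {S} → IsOneMinor (suc n) (addToRow a (suc n) X) S → IsOneMinor n X (erase n S)
erase-minor {n} {X} a b al addable 1≤n (k , 1≤k , k≤1+n , refl) with k ≟ suc n
... | no k≢1+n = k , 1≤k , k≤n , sym (erase-minus-addToRow a k inv al addable 1≤k k≤n)
  where
  inv = Built⇒Invariants b
  k≤n = ≤-pred (≤∧≢⇒< k≤1+n k≢1+n)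
... | yes refl = n , 1≤n , ≤-refl , (begin
  X minus n                                     ≡⟨ erase-largest b 1≤n ⟨
  erase n X                                     ≡⟨ cong (erase n) (addToRow-minus-new a (Built⇒Invariants b) al addable) ⟨
  erase n (addToRow a (suc n) X minus suc n)    ∎)
  where open ≡-Reasoning

Minors⊆-restrict : ∀ {n X X′} a a′ → Built n X → a ≤ length X → Addable a X → Built n X′ → a′ ≤ length X′ → Addable a′ X′ →
  Minors⊆ (suc n) (addToRow a (suc n) X) (addToRow a′ (suc n) X′) → Minors⊆ n X X′
Minors⊆-restrict {n} {X} {X′} a a′ b al addable b′ al′ addable′ sub = minors⊆ λ where
  (m , 1≤m , m≤n , refl) → subst (IsOneMinor n X′) (erase-minus-addToRow a m (Built⇒Invariants b) al addable 1≤m m≤n)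
    (erase-minor a′ b′ al′ addable′ (≤-trans 1≤m m≤n) (included sub (m , 1≤m , m≤n⇒m≤1+n m≤n , refl)))

-- Corners

record CornerOutside (Y : Tableau) (b : ℕ) : Set where
  field
    row col value : ℕ
    row≢b         : row ≢ b
    entry         : get Y row col ≡ just value
    atEnd         : rowLength Y row ≡ suc col
    below         : rowLength Y (suc row) ≤ col

rowEnd-corner : ∀ Y i b → rowLength Y (suc i) < rowLength Y i → i ≢ b → CornerOutside Y b
rowEnd-corner Y i b shorter i≢b with rowLength Y i in eq
... | suc j = record
  { row = i ; col = j ; value = proj₁ cell ; row≢b = i≢b ; entry = proj₂ cell ; atEnd = eq ; below = ≤-pred shorter }
  where cell = <⇒get-just Y i j (≤-reflexive (sym eq))

rowLength-delCell-corner : ∀ Y i j i′ → All NonEmpty Y → rowLength Y i ≡ suc j → rowLength Y (suc i) ≤ j → i′ ≢ i →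
  rowLength (delCell Y i j) i′ ≡ rowLength Y i′
rowLength-delCell-corner (row ∷ Y) zero j zero _ _ _ i′≢i = ⊥-elim (i′≢i refl)
rowLength-delCell-corner (row ∷ Y) zero j (suc i′) (_ ∷ ne) atEnd below _ with delRow row j in eq
... | y ∷ ys = refl
rowLength-delCell-corner (row ∷ []) zero j (suc i′) _ _ _ _ | [] = refl
rowLength-delCell-corner (row ∷ row₁ ∷ Y) zero j (suc i′) (_ ∷ ne₁ ∷ _) atEnd below _ | []
  with delRow-nil⇒0 row j (≤-reflexive (sym atEnd)) eq
... | refl = ⊥-elim (ne₁ (length≡0 below))
  where
  length≡0 : ∀ {xs : List ℕ} → length xs ≤ 0 → xs ≡ []
  length≡0 {[]} _ = refl
rowLength-delCell-corner (row ∷ Y) (suc i) j zero _ _ _ _ = refl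
rowLength-delCell-corner (row ∷ Y) (suc i) j (suc i′) (_ ∷ ne) atEnd below i′≢i =
  rowLength-delCell-corner Y i j i′ ne atEnd below (i′≢i ∘ cong suc)

minus-corner-rowLength : ∀ {n U b} → Invariants n U → (corner : CornerOutside U b) →
  rowLength (U minus CornerOutside.value corner) b ≡ rowLength U b
minus-corner-rowLength {n} {U} {b} inv corner = begin
  rowLength (U minus value) b                         ≡⟨ cong (λ T → rowLength T b) (minus-at U value unique entry) ⟩
  rowLength (renumber value (slide (size U) U row col)) b ≡⟨ rowLength-map-map (shift value) (slide (size U) U row col) b ⟩
  rowLength (slide (size U) U row col) b              ≡⟨ cong (λ T → rowLength T b) (slide-stuck (size U) U row col (endOfRow , nothingBelow)) ⟩
  rowLength (delCell U row col) b                     ≡⟨ rowLength-delCell-corner U row col b nonEmpty atEnd below (row≢b ∘ sym) ⟩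
  rowLength U b                                       ∎
  where
  open ≡-Reasoning
  open Invariants inv
  open CornerOutside corner
  endOfRow = ≤⇒get-nothing U row (suc col) (≤-reflexive atEnd)
  nothingBelow = ≤⇒get-nothing U (suc row) col below

-- Deleting the corner leaves row b of U one cell longer than in X, whereas no
-- 1-minor of U′ has row b longer than X does.
corner-distinguishes : ∀ {n X} b b′ → Invariants n X →
  b ≤ length X → Addable b X → b′ ≤ length X → Addable b′ X → b ≢ b′ →
  CornerOutside (addToRow b (suc n) X) b →
  ¬ Minors⊆ (suc n) (addToRow b (suc n) X) (addToRow b′ (suc n) X)
corner-distinguishes {n} {X} b b′ inv bl addable bl′ addable′ b≢b′ corner sub
  with included sub (Invariants.minus-isOneMinor invU (CornerOutside.entry corner))
  where invU = Invariants-grow b inv bl addable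
... | k , _ , _ , same = <⇒≱ longer (begin
  rowLength (U minus value) b     ≡⟨ cong (λ T → rowLength T b) same ⟨
  rowLength (U′ minus k) b        ≤⟨ minus-rowLength≤ U′ k (Invariants.young (Invariants-grow b′ inv bl′ addable′)) b ⟩
  rowLength U′ b                  ≡⟨ rowLength-addToRow-other b′ (suc n) X b bl′ b≢b′ ⟩
  rowLength X b                   ∎)
  where
  open CornerOutside corner
  open ≤-Reasoning
  U = addToRow b (suc n) X
  U′ = addToRow b′ (suc n) X
  longer : rowLength X b < rowLength (U minus value) b
  longer = ≤-reflexive (sym (trans (minus-corner-rowLength (Invariants-grow b inv bl addable) corner)
                                   (rowLength-addToRow-same b (suc n) X bl)))

rowLength-beyond : ∀ Y k → length Y ≤ k → rowLength Y k ≡ 0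
rowLength-beyond []        k       _         = refl
rowLength-beyond (row ∷ Y) (suc k) (s≤s le) = rowLength-beyond Y k le

rowLength-nonEmpty : ∀ Y i → All NonEmpty Y → i < length Y → 0 < rowLength Y i
rowLength-nonEmpty ([] ∷ Y)       zero    (ne ∷ _) _         = ⊥-elim (ne refl)
rowLength-nonEmpty ((x ∷ xs) ∷ Y) zero    _        _         = s≤s z≤n
rowLength-nonEmpty (row ∷ Y)      (suc i) (_ ∷ ne) (s≤s lt) = rowLength-nonEmpty Y i ne lt

size-singleCell : ∀ X → length X ≡ 1 → rowLength X 0 ≡ 1 → size X ≡ 1
size-singleCell ((x ∷ []) ∷ []) _ _ = refl

shortLastRow-corner : ∀ {n X} p w → Invariants n X → 2 ≤ n → length X ≡ suc p → Addable p X → rowLength X p ≡ 1 →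
  CornerOutside (addToRow (suc p) w X) (suc p)
shortLastRow-corner {X = X} zero w inv 2≤n len≡ _ ℓ≡1 =
  ⊥-elim (<⇒≱ 2≤n (≤-reflexive (trans (sym (Invariants.size≡ inv)) (size-singleCell X len≡ ℓ≡1))))
shortLastRow-corner {X = X} (suc p) w inv 2≤n len≡ addable ℓ≡1 = rowEnd-corner Y p (suc (suc p))
  (subst₂ _<_ (sym (trans (rowLength-addToRow-other (suc (suc p)) w X (suc p) al (1+n≢n ∘ sym)) ℓ≡1))
              (sym (rowLength-addToRow-other (suc (suc p)) w X p al p≢2+p))
              (subst (_< rowLength X p) ℓ≡1 addable))
  p≢2+p
  where
  Y = addToRow (suc (suc p)) w X
  al = ≤-reflexive (sym len≡)
  p≢2+p = <⇒≢ (m<n+m p {2} (s≤s z≤n))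

newRow-corner : ∀ {n X} p w → Invariants n X → 2 ≤ n → length X ≡ suc p → Addable p X →
  CornerOutside (addToRow (suc p) w X) (suc p)
newRow-corner {n} {X} p w inv 2≤n len≡ addable = byLength (rowLength X p) refl
  where
  open Invariants inv
  Y = addToRow (suc p) w X
  al = ≤-reflexive (sym len≡)
  newRow : rowLength Y (suc p) ≡ 1
  newRow = trans (rowLength-addToRow-same (suc p) w X al) (cong suc (rowLength-beyond X (suc p) (≤-reflexive len≡)))
  byLength : ∀ ℓ → rowLength X p ≡ ℓ → CornerOutside Y (suc p)
  byLength zero          ℓ≡ = ⊥-elim (<⇒≢ (rowLength-nonEmpty X p nonEmpty (≤-reflexive (sym len≡))) (sym ℓ≡))
  byLength 1             ℓ≡ = shortLastRow-corner p w inv 2≤n len≡ addable ℓ≡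
  byLength (suc (suc j)) ℓ≡ = rowEnd-corner Y p (suc p)
    (subst₂ _<_ (sym newRow) (sym (trans (rowLength-addToRow-other (suc p) w X p al (<⇒≢ (n<1+n p))) ℓ≡)) (s≤s (s≤s z≤n)))
    (<⇒≢ (n<1+n p))

addToRow-corner : ∀ {n X} a p w → Invariants n X → 2 ≤ n → length X ≡ suc p → a ≤ length X → a ≢ p →
  (a ≡ suc p → Addable p X) → CornerOutside (addToRow a w X) a
addToRow-corner {n} {X} a p w inv 2≤n len≡ al a≢p addable with m≤n⇒m<n∨m≡n al
... | inj₁ a<len = rowEnd-corner Y p a (begin-strict
  rowLength Y (suc p)   ≡⟨ rowLength-addToRow-other a w X (suc p) al (λ e → <⇒≢ a<len (trans (sym e) (sym len≡))) ⟩
  rowLength X (suc p)   ≡⟨ rowLength-beyond X (suc p) (≤-reflexive len≡) ⟩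
  0                     <⟨ rowLength-nonEmpty X p (Invariants.nonEmpty inv) (≤-reflexive (sym len≡)) ⟩
  rowLength X p         ≡⟨ rowLength-addToRow-other a w X p al (a≢p ∘ sym) ⟨
  rowLength Y p         ∎) (a≢p ∘ sym)
  where
  open ≤-Reasoning
  Y = addToRow a w X
... | inj₂ a≡len with trans a≡len len≡
...   | refl = newRow-corner p w inv 2≤n len≡ (addable refl)

length-pred : ∀ X → 0 < size X → ∃[ p ] length X ≡ suc p
length-pred (row ∷ X) _ = length X , refl

-- With p the last row of X, an extension whose new cell is not in row p has a
-- corner outside that cell's row; for a new row below X this needs row p addable.
distinct-additions-distinguishable : ∀ {n X} a a′ → Invariants n X → 2 ≤ n →
  a ≤ length X → Addable a X → a′ ≤ length X → Addable a′ X → a ≢ a′ →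
  Minors⊆ (suc n) (addToRow a (suc n) X) (addToRow a′ (suc n) X) →
  Minors⊆ (suc n) (addToRow a′ (suc n) X) (addToRow a (suc n) X) → ⊥
distinct-additions-distinguishable {n} {X} a a′ inv 2≤n al addable al′ addable′ a≢a′ sub sub′
  with length-pred X (subst (0 <_) (sym (Invariants.size≡ inv)) (≤-trans (s≤s z≤n) 2≤n))
... | p , len≡ with a ≟ p
...   | yes refl = corner-distinguishes a′ a inv al′ addable′ al addable (a≢a′ ∘ sym)
                     (addToRow-corner a′ p _ inv 2≤n len≡ al′ (a≢a′ ∘ sym) (λ _ → addable)) sub′
...   | no a≢p with a ≟ suc p | a′ ≟ p
...     | yes refl | yes refl = corner-distinguishes a a′ inv al addable al′ addable′ a≢a′
                                  (addToRow-corner a p _ inv 2≤n len≡ al a≢p (λ _ → addable′)) sub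
...     | yes refl | no a′≢p  = corner-distinguishes a′ a inv al′ addable′ al addable (a≢a′ ∘ sym)
                                  (addToRow-corner a′ p _ inv 2≤n len≡ al′ a′≢p (⊥-elim ∘ a≢a′ ∘ sym)) sub′
...     | no a≢1+p | _        = corner-distinguishes a a′ inv al addable al′ addable′ a≢a′
                                  (addToRow-corner a p _ inv 2≤n len≡ al a≢p (⊥-elim ∘ a≢1+p)) sub

-- Exceptional pairs and the induction

∈-oneTo⁺ : ∀ {m n} → 1 ≤ m → m ≤ n → m ∈ oneTo n
∈-oneTo⁺ {suc m} _ m<n = ∈-map⁺ suc (∈-upTo⁺ m<n)

∈-oneTo⁻ : ∀ {m n} → m ∈ oneTo n → 1 ≤ m × m ≤ n
∈-oneTo⁻ m∈ with _ , i∈ , refl ← ∈-map⁻ suc m∈ = s≤s z≤n , ∈-upTo⁻ i∈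

minors : ℕ → Tableau → List Tableau
minors n T = map (T minus_) (oneTo n)

Minors⊆⇒All : ∀ {n T T′} → Minors⊆ n T T′ → All (_∈ minors n T′) (minors n T)
Minors⊆⇒All {n} {T} {T′} sub =
  All.map⁺ (All.tabulate λ m∈ → minor∈minors (included sub (_ , ∈-oneTo⁻ m∈ .proj₁ , ∈-oneTo⁻ m∈ .proj₂ , refl)))
  where
  minor∈minors : ∀ {S} → IsOneMinor n T′ S → S ∈ minors n T′
  minor∈minors (m , 1≤m , m≤n , refl) = ∈-map⁺ (T′ minus_) (∈-oneTo⁺ 1≤m m≤n)

minorsIncluded? : ∀ n T T′ → Dec (All (_∈ minors n T′) (minors n T))
minorsIncluded? n T T′ = All.all? (_∈? minors n T′) (minors n T)

-- For concrete tableaux the implicit argument is found by evaluating the decision.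
distinguishable : ∀ {n T T′} {_ : False (minorsIncluded? n T T′ ×-dec minorsIncluded? n T′ T)} →
  Minors⊆ n T T′ → Minors⊆ n T′ T → ⊥
distinguishable {_} {_} {_} {different} sub sub′ = toWitnessFalse different (Minors⊆⇒All sub , Minors⊆⇒All sub′)

-- Distinct tableaux with the same 1-minors.
data ExceptionalPair : ℕ → Tableau → Tableau → Set where
  row-column : ExceptionalPair 2 ((1 ∷ 2 ∷ []) ∷ []) ((1 ∷ []) ∷ (2 ∷ []) ∷ [])
  hook       : ExceptionalPair 3 ((1 ∷ 2 ∷ []) ∷ (3 ∷ []) ∷ []) ((1 ∷ 3 ∷ []) ∷ (2 ∷ []) ∷ [])
  square     : ExceptionalPair 4 ((1 ∷ 2 ∷ []) ∷ (3 ∷ 4 ∷ []) ∷ []) ((1 ∷ 3 ∷ []) ∷ (2 ∷ 4 ∷ []) ∷ [])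

data Exceptional (n : ℕ) (T T′ : Tableau) : Set where
  pair : ExceptionalPair n T T′ → Exceptional n T T′
  swap : ExceptionalPair n T′ T → Exceptional n T T′

Exceptional-sym : ∀ {n T T′} → Exceptional n T T′ → Exceptional n T′ T
Exceptional-sym (pair e) = swap e
Exceptional-sym (swap e) = pair e

ExceptionalPair-≤4 : ∀ {n T T′} → ExceptionalPair n T T′ → n ≤ 4
ExceptionalPair-≤4 row-column = s≤s (s≤s z≤n)
ExceptionalPair-≤4 hook       = s≤s (s≤s (s≤s z≤n))
ExceptionalPair-≤4 square     = ≤-refl

Exceptional-≤4 : ∀ {n T T′} → Exceptional n T T′ → n ≤ 4
Exceptional-≤4 (pair e) = ExceptionalPair-≤4 e
Exceptional-≤4 (swap e) = ExceptionalPair-≤4 e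

ExceptionalPair-grow : ∀ {n X X′} → ExceptionalPair n X X′ → ∀ a a′ →
  a ≤ length X → Addable a X → a′ ≤ length X′ → Addable a′ X′ →
  Minors⊆ (suc n) (addToRow a (suc n) X) (addToRow a′ (suc n) X′) →
  Minors⊆ (suc n) (addToRow a′ (suc n) X′) (addToRow a (suc n) X) →
  Exceptional (suc n) (addToRow a (suc n) X) (addToRow a′ (suc n) X′)
ExceptionalPair-grow row-column 0 0 _ _ _ _  s s′ = ⊥-elim (distinguishable s s′)
ExceptionalPair-grow row-column 0 2 _ _ _ _  s s′ = ⊥-elim (distinguishable s s′)
ExceptionalPair-grow row-column 1 0 _ _ _ _  s s′ = pair hook
ExceptionalPair-grow row-column 1 2 _ _ _ _  s s′ = ⊥-elim (distinguishable s s′)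
ExceptionalPair-grow row-column _ 1 _ _ _ (s≤s ()) s s′
ExceptionalPair-grow row-column (suc (suc a)) _ (s≤s ()) _ _ _ s s′
ExceptionalPair-grow row-column _ (suc (suc (suc a′))) _ _ (s≤s (s≤s ())) _ s s′
ExceptionalPair-grow hook 0 0 _ _ _ _ s s′ = ⊥-elim (distinguishable s s′)
ExceptionalPair-grow hook 0 1 _ _ _ _ s s′ = ⊥-elim (distinguishable s s′)
ExceptionalPair-grow hook 0 2 _ _ _ _ s s′ = ⊥-elim (distinguishable s s′)
ExceptionalPair-grow hook 1 0 _ _ _ _ s s′ = ⊥-elim (distinguishable s s′)
ExceptionalPair-grow hook 1 1 _ _ _ _ s s′ = pair square
ExceptionalPair-grow hook 1 2 _ _ _ _ s s′ = ⊥-elim (distinguishable s s′)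
ExceptionalPair-grow hook 2 0 _ _ _ _ s s′ = ⊥-elim (distinguishable s s′)
ExceptionalPair-grow hook 2 1 _ _ _ _ s s′ = ⊥-elim (distinguishable s s′)
ExceptionalPair-grow hook 2 2 _ _ _ _ s s′ = ⊥-elim (distinguishable s s′)
ExceptionalPair-grow hook (suc (suc (suc a))) _ (s≤s (s≤s ())) _ _ _ s s′
ExceptionalPair-grow hook _ (suc (suc (suc a′))) _ _ (s≤s (s≤s ())) _ s s′
ExceptionalPair-grow square 0 0 _ _ _ _ s s′ = ⊥-elim (distinguishable s s′)
ExceptionalPair-grow square 0 2 _ _ _ _ s s′ = ⊥-elim (distinguishable s s′)
ExceptionalPair-grow square 2 0 _ _ _ _ s s′ = ⊥-elim (distinguishable s s′)
ExceptionalPair-grow square 2 2 _ _ _ _ s s′ = ⊥-elim (distinguishable s s′)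
ExceptionalPair-grow square 1 _ _ (s≤s (s≤s ())) _ _ s s′
ExceptionalPair-grow square _ 1 _ _ _ (s≤s (s≤s ())) s s′
ExceptionalPair-grow square (suc (suc (suc a))) _ (s≤s (s≤s ())) _ _ _ s s′
ExceptionalPair-grow square _ (suc (suc (suc a′))) _ _ (s≤s (s≤s ())) _ s s′

Exceptional-grow : ∀ {n X X′} → Exceptional n X X′ → ∀ a a′ →
  a ≤ length X → Addable a X → a′ ≤ length X′ → Addable a′ X′ →
  Minors⊆ (suc n) (addToRow a (suc n) X) (addToRow a′ (suc n) X′) →
  Minors⊆ (suc n) (addToRow a′ (suc n) X′) (addToRow a (suc n) X) →
  Exceptional (suc n) (addToRow a (suc n) X) (addToRow a′ (suc n) X′)
Exceptional-grow (pair e) a a′ al addable al′ addable′ s s′ = ExceptionalPair-grow e a a′ al addable al′ addable′ s s′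
Exceptional-grow (swap e) a a′ al addable al′ addable′ s s′ =
  Exceptional-sym (ExceptionalPair-grow e a′ a al′ addable′ al addable s′ s)

distinct-additions⇒Exceptional : ∀ n {X} a a′ → Built n X → a ≤ length X → Addable a X → a′ ≤ length X → Addable a′ X → a ≢ a′ →
  Minors⊆ (suc n) (addToRow a (suc n) X) (addToRow a′ (suc n) X) →
  Minors⊆ (suc n) (addToRow a′ (suc n) X) (addToRow a (suc n) X) →
  Exceptional (suc n) (addToRow a (suc n) X) (addToRow a′ (suc n) X)
distinct-additions⇒Exceptional 0 0 0 [] _ _ _ _ a≢a′ _ _ = ⊥-elim (a≢a′ refl)
distinct-additions⇒Exceptional 1 0 1 (grow _ [] _ _) _ _ _ _ _ _ _ = pair row-column
distinct-additions⇒Exceptional 1 1 0 (grow _ [] _ _) _ _ _ _ _ _ _ = swap row-column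
distinct-additions⇒Exceptional 1 0 0 (grow _ [] _ _) _ _ _ _ a≢a′ _ _ = ⊥-elim (a≢a′ refl)
distinct-additions⇒Exceptional 1 1 1 (grow _ [] _ _) _ _ _ _ a≢a′ _ _ = ⊥-elim (a≢a′ refl)
distinct-additions⇒Exceptional 1 (suc (suc a)) _ (grow _ [] _ _) (s≤s ()) _ _ _ _ _ _
distinct-additions⇒Exceptional 1 _ (suc (suc a′)) (grow _ [] _ _) _ _ (s≤s ()) _ _ _ _
distinct-additions⇒Exceptional (suc (suc n)) a a′ b al addable al′ addable′ a≢a′ s s′ =
  ⊥-elim (distinct-additions-distinguishable a a′ (Built⇒Invariants b) (s≤s (s≤s z≤n)) al addable al′ addable′ a≢a′ s s′)

reconstruct : ∀ n {T T′} → Built n T → Built n T′ → Minors⊆ n T T′ → Minors⊆ n T′ T → T ≡ T′ ⊎ Exceptional n T T′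
reconstruct zero [] [] _ _ = inj₁ refl
reconstruct (suc n) (grow a b al addable) (grow a′ b′ al′ addable′) s s′
  with reconstruct n b b′ (Minors⊆-restrict a a′ b al addable b′ al′ addable′ s) (Minors⊆-restrict a′ a b′ al′ addable′ b al addable s′)
... | inj₂ exc = inj₂ (Exceptional-grow exc a a′ al addable al′ addable′ s s′)
... | inj₁ refl with a ≟ a′
...   | yes refl = inj₁ refl
...   | no a≢a′  = inj₂ (distinct-additions⇒Exceptional n a a′ b al addable al′ addable′ a≢a′ s s′)

-- Standard Young tableaux are grown tableaux

oneTo-suc : ∀ n → oneTo (suc n) ≡ oneTo n ++ [ suc n ]
oneTo-suc n = trans (cong (map suc) (sym (upTo-∷ʳ n))) (map-++ suc (upTo n) [ n ])

concat-middle : ∀ pre (row : List ℕ) post → concat (pre ++ row ∷ post) ≡ concat pre ++ row ++ concat post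
concat-middle pre row post = sym (concat-++ pre (row ∷ post))

rows-range : ∀ {n T} → IsSYT n T → All (All (λ v → 1 ≤ v × v ≤ n)) T
rows-range sT = All.concat⁻ (All-resp-↭ (↭-sym (IsSYT.entries sT)) (All.tabulate ∈-oneTo⁻))

Linked-middle : ∀ {A : Set} {R : A → A → Set} xs {x y ys} → Linked R (xs ++ x ∷ y ∷ ys) → R x y
Linked-middle []       (r ∷ _) = r
Linked-middle (u ∷ xs) l       = Linked-middle xs (Linked.tail l)

Linked-prefix : ∀ {A : Set} {R : A → A → Set} xs {ys} → Linked R (xs ++ ys) → Linked R xs
Linked-prefix []           _       = []
Linked-prefix (x ∷ [])     _       = [-]
Linked-prefix (x ∷ y ∷ xs) (r ∷ l) = r ∷ Linked-prefix (y ∷ xs) l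

Linked-replace : ∀ {A : Set} {R : A → A → Set} {P : A → Set} pre x x′ post → All P post →
  (∀ {u} → R u x → R u x′) → (∀ {v} → P v → R x v → R x′ v) → Linked R (pre ++ x ∷ post) → Linked R (pre ++ x′ ∷ post)
Linked-replace []            x x′ []         _        above below _       = [-]
Linked-replace []            x x′ (v ∷ post) (pv ∷ _) above below (r ∷ l) = below pv r ∷ l
Linked-replace (u ∷ [])      x x′ post       ps       above below (r ∷ l) = above r ∷ Linked-replace [] x x′ post ps above below l
Linked-replace (u ∷ u′ ∷ pre) x x′ post      ps       above below (r ∷ l) = r ∷ Linked-replace (u′ ∷ pre) x x′ post ps above below l

Above-init : ∀ {u} ys {y} → Above u (ys ++ [ y ]) → Above u ys
Above-init []       _               = above-[]
Above-init (z ∷ ys) (above-∷ lt a) = above-∷ lt (Above-init ys a)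

Above-dropLast : ∀ xs {s v} → All (_≤ s) v → Above (xs ++ [ s ]) v → Above xs v
Above-dropLast xs       {v = []}    _          _              = above-[]
Above-dropLast []       {v = y ∷ v} (y≤s ∷ _)  (above-∷ lt _) = ⊥-elim (<⇒≱ lt y≤s)
Above-dropLast (x ∷ xs) {v = y ∷ v} (_ ∷ ≤s)   (above-∷ lt a) = above-∷ lt (Above-dropLast xs ≤s a)

Above-length : ∀ {xs ys} → Above xs ys → length ys ≤ length xs
Above-length above-[]       = z≤n
Above-length (above-∷ _ a) = s≤s (Above-length a)

Linked-Above⇒Young : ∀ T → Linked Above T → Young T
Linked-Above⇒Young []             _       i       = z≤n
Linked-Above⇒Young (r ∷ [])       _       zero    = z≤n
Linked-Above⇒Young (r ∷ [])       _       (suc i) = z≤n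
Linked-Above⇒Young (r ∷ r′ ∷ T) (a ∷ l) zero    = Above-length a
Linked-Above⇒Young (r ∷ r′ ∷ T) (a ∷ l) (suc i) = Linked-Above⇒Young (r′ ∷ T) l i

Young⇒Addable : ∀ a s X → a ≤ length X → Young (addToRow a s X) → Addable a X
Young⇒Addable zero    s X al young = tt
Young⇒Addable (suc a) s X al young =
  subst₂ _≤_ (rowLength-addToRow-same (suc a) s X al) (rowLength-addToRow-other (suc a) s X a al (1+n≢n ∘ sym)) (young a)

addToRow-middle : ∀ pre r post s → addToRow (length pre) s (pre ++ r ∷ post) ≡ pre ++ (r ++ [ s ]) ∷ post
addToRow-middle []        r post s = refl
addToRow-middle (p ∷ pre) r post s = cong (p ∷_) (addToRow-middle pre r post s)

addToRow-end : ∀ pre s → addToRow (length pre) s pre ≡ pre ++ [ s ] ∷ []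
addToRow-end []        s = refl
addToRow-end (p ∷ pre) s = cong (p ∷_) (addToRow-end pre s)

largest-split : ∀ {k T} → IsSYT (suc k) T → ∃[ pre ] ∃[ r ] ∃[ post ] T ≡ pre ++ (r ++ [ suc k ]) ∷ post
largest-split {k} {T} sT with ∈-concat⁻′ T (∈-resp-↭ (↭-sym (IsSYT.entries sT)) (∈-oneTo⁺ (s≤s z≤n) ≤-refl))
... | row , s∈row , row∈T with ∈-∃++ row∈T | ∈-∃++ s∈row
...   | pre , post , T≡ | r , []    , row≡ = pre , r , post , trans T≡ (cong (λ x → pre ++ x ∷ post) row≡)
...   | pre , post , T≡ | r , y ∷ q , row≡ = ⊥-elim (<⇒≱ s<y y≤s)
  where
  s<y : suc k < y
  s<y = Linked-middle r (subst (Linked _<_) row≡ (All.lookup (IsSYT.rowsIncr sT) row∈T))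
  y≤s : y ≤ suc k
  y≤s = proj₂ (All.lookup (All.lookup (rows-range sT) row∈T) (subst (y ∈_) (sym row≡) (∈-++⁺ʳ r (there (here refl)))))

IsSYT-removeEnd : ∀ {k} pre r post → NonEmpty r → IsSYT (suc k) (pre ++ (r ++ [ suc k ]) ∷ post) → IsSYT k (pre ++ r ∷ post)
IsSYT-removeEnd {k} pre r post r≢[] sT = record
  { rowsNonEmpty = All.++⁺ (All.++⁻ˡ pre rowsNonEmpty) (r≢[] ∷ All.tail (All.++⁻ʳ pre rowsNonEmpty))
  ; entries      = subst₂ _↭_ (trans (++-assoc (concat pre) r (concat post)) (sym (concat-middle pre r post))) (++-identityʳ (oneTo k))
                     (drop-mid (concat pre ++ r) (oneTo k) (subst₂ _↭_ concat≡ (oneTo-suc k) entries))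
  ; rowsIncr     = All.++⁺ (All.++⁻ˡ pre rowsIncr)
                     (Linked-prefix r (All.head (All.++⁻ʳ pre rowsIncr)) ∷ All.tail (All.++⁻ʳ pre rowsIncr))
  ; colsIncr     = Linked-replace pre (r ++ [ s ]) r post (All.tail (All.++⁻ʳ pre (All.map (All.map proj₂) (rows-range sT))))
                     (Above-init r) (Above-dropLast r) colsIncr
  }
  where
  open IsSYT sT
  s = suc k
  concat≡ : concat (pre ++ (r ++ [ s ]) ∷ post) ≡ (concat pre ++ r) ++ [ s ] ++ concat post
  concat≡ = begin
    concat (pre ++ (r ++ [ s ]) ∷ post)        ≡⟨ concat-middle pre (r ++ [ s ]) post ⟩
    concat pre ++ (r ++ [ s ]) ++ concat post  ≡⟨ cong (concat pre ++_) (++-assoc r [ s ] (concat post)) ⟩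
    concat pre ++ r ++ [ s ] ++ concat post    ≡⟨ ++-assoc (concat pre) r ([ s ] ++ concat post) ⟨
    (concat pre ++ r) ++ [ s ] ++ concat post  ∎
    where open ≡-Reasoning

IsSYT-removeLastRow : ∀ {k} pre → IsSYT (suc k) (pre ++ [ suc k ] ∷ []) → IsSYT k pre
IsSYT-removeLastRow {k} pre sT = record
  { rowsNonEmpty = All.++⁻ˡ pre rowsNonEmpty
  ; entries      = subst₂ _↭_ (++-identityʳ (concat pre)) (++-identityʳ (oneTo k))
                     (drop-mid (concat pre) (oneTo k) (subst₂ _↭_ (concat-middle pre [ suc k ] []) (oneTo-suc k) entries))
  ; rowsIncr     = All.++⁻ˡ pre rowsIncr
  ; colsIncr     = Linked-prefix pre colsIncr
  }
  where open IsSYT sT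

IsSYT-singletonIsLast : ∀ {k} pre row post → ¬ IsSYT (suc k) (pre ++ [ suc k ] ∷ row ∷ post)
IsSYT-singletonIsLast {k} pre row post sT with Linked-middle pre (IsSYT.colsIncr sT) | All.++⁻ʳ pre (IsSYT.rowsNonEmpty sT)
... | above-[]       | _ ∷ row≢[] ∷ _ = row≢[] refl
... | above-∷ s<y _ | _ = <⇒≱ s<y (proj₂ (All.head (All.head (All.tail (All.++⁻ʳ pre (rows-range sT))))))

IsSYT⇒Built : ∀ {n T} → IsSYT n T → Built n T
IsSYT⇒Built {zero}  {[]}      _  = []
IsSYT⇒Built {zero}  {[] ∷ T}  sT = ⊥-elim (All.head (IsSYT.rowsNonEmpty sT) refl)
IsSYT⇒Built {zero}  {(x ∷ row) ∷ T} sT with () ← ↭-empty-inv (IsSYT.entries sT)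
IsSYT⇒Built {suc k} sT with largest-split sT
... | pre , []      , []         , refl =
  subst (Built (suc k)) (addToRow-end pre (suc k))
    (grow (length pre) (IsSYT⇒Built (IsSYT-removeLastRow pre sT)) ≤-refl
      (Young⇒Addable (length pre) (suc k) pre ≤-refl
        (subst Young (sym (addToRow-end pre (suc k))) (Linked-Above⇒Young _ (IsSYT.colsIncr sT)))))
... | pre , []      , row ∷ post , refl = ⊥-elim (IsSYT-singletonIsLast pre row post sT)
... | pre , x ∷ r   , post       , refl =
  subst (Built (suc k)) (addToRow-middle pre (x ∷ r) post (suc k))
    (grow (length pre) (IsSYT⇒Built (IsSYT-removeEnd pre (x ∷ r) post (λ ()) sT)) pre≤
      (Young⇒Addable (length pre) (suc k) (pre ++ (x ∷ r) ∷ post) pre≤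
        (subst Young (sym (addToRow-middle pre (x ∷ r) post (suc k))) (Linked-Above⇒Young _ (IsSYT.colsIncr sT)))))
  where
  pre≤ : length pre ≤ length (pre ++ (x ∷ r) ∷ post)
  pre≤ = subst (length pre ≤_) (sym (length-++ pre)) (m≤m+n _ _)

mainTheorem7 : (n : ℕ) → 5 ≤ n → (T T′ : SYT n) →
    ((S : Tableau) → (IsOneMinor n (proj₁ T) S → IsOneMinor n (proj₁ T′) S) × (IsOneMinor n (proj₁ T′) S → IsOneMinor n (proj₁ T) S)) →
    proj₁ T ≡ proj₁ T′
mainTheorem7 n 5≤n (T , sT) (T′ , sT′) sameMinors
  with reconstruct n (IsSYT⇒Built sT) (IsSYT⇒Built sT′) (minors⊆ (proj₁ (sameMinors _))) (minors⊆ (proj₂ (sameMinors _)))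
... | inj₁ T≡T′ = T≡T′
... | inj₂ exc  = ⊥-elim (<⇒≱ 5≤n (Exceptional-≤4 exc))
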